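{- Let $N$ be a finite, commutative, partly cancellative nilsemigroup with identity, and let $p \in N \setminus \{\infty\}$ be a maximal element of $N$. Suppose there are $k$ minimal relations occurring at $p$ (i.e. a minimal presentation of $N$ contains exactly $k$ trades $(z,z')$ with $\varphi_N(z) = p$). Then $b(N) + k + 1 - b(N/p)$ equals the number of outer Betti elements of $N$ that are divisible by $p$. In particular, $b(N/p) - 1 \le b(N) + k$.
   Context: A nilsemigroup is a commutative semigroup $(N,+)$ with an absorbing element $\infty$ (the nil), i.e. $a + \infty = \infty$ for all $a$. Here $N$ is finite, has an identity $0$, and is partly cancellative: $a + b = a + c \neq \infty$ implies $b = c$. Its atoms are its minimal generators (nonzero non-nil elements that are not a sum of two nonzero elements); let $n_1,\dots,n_k'$ be the atoms. The factorization homomorphism $\varphi_N:\mathbb{Z}_{\ge 0}^{k'} \to N$ sends $z$ to $z_1 n_1 + \cdots + z_{k'} n_{k'}$, and $\mathsf Z_N(p) = \varphi_N^{ -1}(p)$ is the set of factorizations of $p$. The kernel $\ker\varphi_N$ is the congruence on $\mathbb{Z}_{\ge 0}^{k'}$ relating $z \sim z'$ when $\varphi_N(z) = \varphi_N(z')$; such a pair is a trade. A minimal presentation of $N$ is obtained from a minimal generating set (as a congruence) of $\ker\varphi_N$ by omitting every trade $(z,z')$ with $\varphi_N(z) = \infty$; its cardinality is independent of choices. For $z \in \mathbb{Z}_{\ge 0}^{k'}$, $\operatorname{supp}(z) = \{i : z_i > 0\}$, and for a set $Z$ of such vectors, $\operatorname{supp}(Z) = \bigcup_{z \in Z}\operatorname{supp}(z)$;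 $\nabla_Z$ is the graph with vertex set $Z$ in which distinct $z,z'$ are adjacent when $\operatorname{supp}(z)\cap\operatorname{supp}(z') \ne \emptyset$; for $i \in \operatorname{supp}(Z)$, $Z - e_i = \{z - e_i : z \in Z,\ i \in \operatorname{supp}(z)\}$. An outer Betti element of $N$ is a subset $B \subseteq \mathsf Z_N(\infty)$ such that (i) for every $i \in \operatorname{supp}(B)$, $B - e_i = \mathsf Z_N(q)$ for some $q \in N \setminus \{\infty\}$, and (ii) $\nabla_B$ is connected. $b(N)$ denotes the number of outer Betti elements of $N$. An outer Betti element $B$ is divisible by $p$ if $B - e_j = \mathsf Z_N(p)$ for some $j \in \operatorname{supp}(B)$. An element $p \in N \setminus \{\infty\}$ is maximal if $p + p' = \infty$ for every nonzero $p' \in N$. For such $p$, the quotient $N/p$ is $N/\!\sim$ where $\sim$ is the congruence whose only nontrivial relation is $p \sim \infty$; thus $\mathsf Z_{N/p}(\infty) = \mathsf Z_N(\infty) \cup \mathsf Z_N(p)$ and $\mathsf Z_{N/p}(p') = \mathsf Z_N(p')$ for $p' \notin \{p,\infty\}$. -}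

module Defs where

open import Data.Nat using (ℕ; zero; suc; _<_; _+_; pred)
open import Data.Fin using (Fin)
import Data.Fin as F
open import Data.Vec using (Vec; []; _∷_; lookup; updateAt; zipWith)
open import Data.List using (List; length; filter; removeAt)
open import Data.List.Membership.Propositional using (_∈_)
open import Data.List.Relation.Unary.All using (All)
open import Data.List.Relation.Unary.Any using (Any)
open import Data.List.Relation.Unary.AllPairs using (AllPairs)
open import Data.Product using (Σ; ∃; _×_; _,_; proj₁)
open import Data.Sum using (_⊎_)
open import Relation.Binary.PropositionalEquality using (_≡_; _≢_)
open import Relation.Binary.Definitions using (DecidableEquality)
open import Relation.Nullary using (¬_)
open import Function.Bundles using (_⇔_)
open import Function.Definitions using (Injective)

multiple : {C : Set} → (C → C → C) → C → ℕ → C → C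
multiple _⊕_ e zero    a = e
multiple _⊕_ e (suc n) a = a ⊕ multiple _⊕_ e n a

record NilSemigroup : Set₁ where
  infixl 6 _⊕_
  field
    Carrier : Set
    _⊕_     : Carrier → Carrier → Carrier
    𝟘       : Carrier
    ∞       : Carrier
    _≟_     : DecidableEquality Carrier
    assoc   : ∀ a b c → (a ⊕ b) ⊕ c ≡ a ⊕ (b ⊕ c)
    comm    : ∀ a b → a ⊕ b ≡ b ⊕ a
    identity : ∀ a → 𝟘 ⊕ a ≡ a
    absorb  : ∀ a → a ⊕ ∞ ≡ ∞
    -- finiteness: an exhaustive list of elements
    elements : List Carrier
    complete : ∀ a → a ∈ elements
    partlyCancel : ∀ a b c → a ⊕ b ≡ a ⊕ c → a ⊕ b ≢ ∞ → b ≡ c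

  _•_ : ℕ → Carrier → Carrier
  n • a = multiple _⊕_ 𝟘 n a

  field
    nilpotent : ∀ a → a ≢ 𝟘 → ∃ λ n → n • a ≡ ∞

  IsAtom : Carrier → Set
  IsAtom a = a ≢ 𝟘 × a ≢ ∞ ×
             ¬ (Σ Carrier λ b → Σ Carrier λ c → b ≢ 𝟘 × c ≢ 𝟘 × a ≡ b ⊕ c)

  IsMaximal : Carrier → Set
  IsMaximal p = p ≢ ∞ × (∀ p' → p' ≢ 𝟘 → p ⊕ p' ≡ ∞)

record AtomEnum (N : NilSemigroup) (k : ℕ) : Set where
  open NilSemigroup N
  field
    atom      : Fin k → Carrier
    injective : Injective _≡_ _≡_ atom
    isAtom    : ∀ i → IsAtom (atom i)
    allAtoms  : ∀ a → IsAtom a → ∃ λ i → atom i ≡ a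

Vecℕ : ℕ → Set
Vecℕ k = Vec ℕ k

_⊞_ : ∀ {k} → Vecℕ k → Vecℕ k → Vecℕ k
_⊞_ = zipWith _+_

InSupp : ∀ {k} → Vecℕ k → Fin k → Set
InSupp z i = 0 < lookup z i

_−e_ : ∀ {k} → Vecℕ k → Fin k → Vecℕ k
z −e i = updateAt z i pred

module Factorization (N : NilSemigroup) {k : ℕ} (A : AtomEnum N k) where
  open NilSemigroup N
  open AtomEnum A

  φ' : ∀ {m} → Vecℕ m → (Fin m → Carrier) → Carrier
  φ' []       f = 𝟘
  φ' (x ∷ xs) f = (x • f F.zero) ⊕ φ' xs (λ i → f (F.suc i))

  φ : Vecℕ k → Carrier
  φ z = φ' z atom

  Z : Carrier → Vecℕ k → Set
  Z q z = φ z ≡ q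

Trade : ℕ → Set
Trade k = Vecℕ k × Vecℕ k

data Gen {k} (ρ : List (Trade k)) : Vecℕ k → Vecℕ k → Set where
  step  : ∀ {a b} → (a , b) ∈ ρ → ∀ u → Gen ρ (a ⊞ u) (b ⊞ u)
  refl  : ∀ {a} → Gen ρ a a
  sym   : ∀ {a b} → Gen ρ a b → Gen ρ b a
  trans : ∀ {a b c} → Gen ρ a b → Gen ρ b c → Gen ρ a c

Generates : ∀ {k} {C : Set} → (Vecℕ k → C) → List (Trade k) → Set
Generates φ ρ = ∀ z z' → Gen ρ z z' ⇔ (φ z ≡ φ z')

MinimalGenerating : ∀ {k} {C : Set} → (Vecℕ k → C) → List (Trade k) → Set
MinimalGenerating φ ρ =
  Generates φ ρ × (∀ (i : Fin (length ρ)) → ¬ Generates φ (removeAt ρ i))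

-- Outer Betti elements (finite sets of vectors represented as lists,
-- compared by membership)

module _ {k : ℕ} where

  MinusE : List (Vecℕ k) → Fin k → Vecℕ k → Set
  MinusE B i y = Σ (Vecℕ k) λ z → z ∈ B × InSupp z i × y ≡ z −e i

  InSuppSet : List (Vecℕ k) → Fin k → Set
  InSuppSet B i = Σ (Vecℕ k) λ z → z ∈ B × InSupp z i

  SuppMeet : Vecℕ k → Vecℕ k → Set
  SuppMeet z z' = ∃ λ i → InSupp z i × InSupp z' i

  data Walk (B : List (Vecℕ k)) : Vecℕ k → Vecℕ k → Set where
    here : ∀ {z} → Walk B z z
    next : ∀ {x y z} → y ∈ B → SuppMeet x y → Walk B y z → Walk B x z

  -- ∇_B is connected (a connected graph is nonempty)
  Connected : List (Vecℕ k) → Set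
  Connected B = (Σ (Vecℕ k) λ z → z ∈ B) ×
                (∀ z z' → z ∈ B → z' ∈ B → Walk B z z')

  -- Outer Betti element with respect to:
  --   ZInf    : the set of factorizations of the nil,
  --   NonNil  : the non-nil elements q,
  --   Zq      : the sets of factorizations Z(q).
  IsOuterBetti : {C : Set} → (Vecℕ k → Set) → (C → Set) → (C → Vecℕ k → Set)
               → List (Vecℕ k) → Set
  IsOuterBetti {C} ZInf NonNil Zq B =
    (∀ z → z ∈ B → ZInf z) ×
    (∀ i → InSuppSet B i →
       Σ C λ q → NonNil q × (∀ y → MinusE B i y ⇔ Zq q y)) ×
    Connected B

  _≋_ : List (Vecℕ k) → List (Vecℕ k) → Set
  B ≋ B' = ∀ z → z ∈ B ⇔ z ∈ B'

  -- "there are exactly n sets B (up to set equality) satisfying P"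
  NumberOf : (List (Vecℕ k) → Set) → ℕ → Set
  NumberOf P n = Σ (List (List (Vecℕ k))) λ L →
    length L ≡ n × All P L × AllPairs (λ B B' → ¬ (B ≋ B')) L ×
    (∀ B → P B → Any (B ≋_) L)

module Betti (N : NilSemigroup) {k : ℕ} (A : AtomEnum N k) where
  open NilSemigroup N
  open Factorization N A

  OuterBetti : List (Vecℕ k) → Set
  OuterBetti = IsOuterBetti (Z ∞) (λ q → q ≢ ∞) Z

  -- N/p: Z_{N/p}(∞) = Z_N(∞) ∪ Z_N(p), non-nil elements are q ∉ {p, ∞},
  -- and Z_{N/p}(q) = Z_N(q) for those.
  OuterBettiQuot : Carrier → List (Vecℕ k) → Set
  OuterBettiQuot p = IsOuterBetti (λ z → Z ∞ z ⊎ Z p z)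
                                  (λ q → q ≢ ∞ × q ≢ p) Z

  DivisibleBy : Carrier → List (Vecℕ k) → Set
  DivisibleBy p B = ∃ λ j → InSuppSet B j × (∀ y → MinusE B j y ⇔ Z p y)

  relationsAt : Carrier → List (Trade k) → ℕ
  relationsAt p ρ = length (filter (λ t → φ (proj₁ t) ≟ p) ρ)

-- An outer Betti element B of N/p either contains a factorization of ∞ or lies inside Z(p): two elements of B
-- adjacent in ∇_B have the same value q + n_i, so φ is constant on B. In the first case B is an outer Betti
-- element of N, and an outer Betti element of N stays one of N/p exactly when no B - e_j equals Z(p), i.e. when
-- it is not divisible by p. In the second case maximality of p makes each w - e_i (w ∈ Z(p)) a non-nil element
-- other than p, and cancellation of atoms identifies B with a connected component of ∇_{Z(p)}. Hence
-- b(N/p) = b(N) - d + c, where c is the number of these components.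
-- Finally c = k + 1. Adding the relations at p of a minimal presentation as edges connects ∇_{Z(p)}, since a
-- relation applied with a nonzero offset only joins factorizations sharing an atom. Each of them joins two
-- components not joined by the later ones: otherwise the remaining relations would already imply it, because
-- factorizations of p sharing an atom are related one level below p, where a relation at p is never applied.
-- Each such edge lowers the number of components by one.

module Submission where

open import Defs hiding (refl; sym; trans)

open import Level using (0ℓ)
open import Algebra.Bundles using (CommutativeSemigroup)
open import Data.Bool using (true; false; if_then_else_)
open import Data.Empty using (⊥-elim)
open import Data.Unit using (⊤; tt)
open import Data.Nat using (ℕ; zero; suc; _+_; _∸_; _<_; _≤_; _<?_; z≤n; s≤s; pred)
import Data.Nat as ℕ
open import Data.Nat.Properties
  using (+-identityʳ; +-suc; +-comm; +-assoc; +-cancelʳ-≡; m+[n∸m]≡n; ≤-trans; n≤1+n; m≤n+m; ≮⇒≥)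
open import Data.Nat.Induction using (<-wellFounded)
open import Data.Nat.Tactic.RingSolver using (solve-∀)
open import Data.Fin using (Fin)
import Data.Fin as Fin
import Data.Fin.Properties as Fin
open import Data.Vec using ([]; _∷_; lookup; replicate; updateAt)
import Data.Vec.Properties as Vec
open import Data.Product using (Σ; ∃; ∃₂; _×_; _,_; proj₁; proj₂; map₁; swap)
open import Data.Product.Properties using () renaming (≡-dec to ×-≡-dec)
open import Data.Sum using (_⊎_; inj₁; inj₂; [_,_]′)
import Data.Sum as Sum
open import Data.List using (List; []; _∷_; _++_; [_]; length; filter; map; concatMap; upTo; removeAt)
open import Data.List.Properties using (length-++; length-map; ++-assoc)
open import Data.List.Membership.Propositional using (_∈_; lose; find)
open import Data.List.Membership.Propositional.Properties
  using (∈-++⁺ˡ; ∈-++⁺ʳ; ∈-++⁻; ∈-map⁺; ∈-filter⁺; ∈-filter⁻; ∈-concatMap⁺; ∈-upTo⁺)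
open import Data.List.Relation.Unary.Any using (Any; here; there; any?)
import Data.List.Relation.Unary.Any as Any
open import Data.List.Relation.Unary.Any.Properties using (Any-⊎⁺; Any-⊎⁻)
import Data.List.Relation.Unary.Any.Properties as Any
open import Data.List.Relation.Unary.All using (All; []; _∷_; all?)
import Data.List.Relation.Unary.All as All
open import Data.List.Relation.Unary.All.Properties using (¬All⇒Any¬)
import Data.List.Relation.Unary.All.Properties as All
open import Data.List.Relation.Unary.AllPairs using (AllPairs; []; _∷_)
import Data.List.Relation.Unary.AllPairs.Properties as AllPairs
open import Data.List.Relation.Binary.Subset.Propositional using (_⊆_)
open import Induction.WellFounded using (Acc; acc)
open import Relation.Binary.Core using (Rel)
open import Relation.Binary.Definitions using (DecidableEquality; Reflexive; Symmetric; Transitive)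
  renaming (Decidable to Decidable₂)
open import Relation.Binary.PropositionalEquality
  using (_≡_; _≢_; refl; sym; trans; cong; cong₂; subst; subst₂; isEquivalence; module ≡-Reasoning)
open import Relation.Binary.Construct.Closure.ReflexiveTransitive using (Star; ε; _◅_; _◅◅_; return)
import Relation.Binary.Construct.Closure.ReflexiveTransitive as Star
open import Relation.Nullary using (¬_; Dec; yes; no; does)
open import Relation.Nullary.Decidable using (_×-dec_; _⊎-dec_; _→-dec_; ¬?)
import Relation.Nullary.Decidable as Dec
open import Relation.Unary using (Pred; Decidable)
open import Relation.Unary.Properties using (∁?)
open import Function using (id; _∘_; _∘′_; case_of_)
open import Function.Bundles using (_⇔_; mk⇔; Equivalence)
open import Function.Properties.Equivalence using () renaming (sym to ⇔-sym; trans to ⇔-trans)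

open Equivalence using (to; from)

module _ {A : Set} where

  Any-cong : {P Q : Pred A 0ℓ} → (∀ {y} → P y ⇔ Q y) → ∀ {xs} → Any P xs ⇔ Any Q xs
  Any-cong P⇔Q = mk⇔ (Any.map (to P⇔Q)) (Any.map (from P⇔Q))

  Any-⊎ : {P Q : Pred A 0ℓ} {xs : List A} → Any (λ y → P y ⊎ Q y) xs ⇔ (Any P xs ⊎ Any Q xs)
  Any-⊎ = mk⇔ Any-⊎⁻ Any-⊎⁺

  sublists : List A → List (List A)
  sublists []       = [ [] ]
  sublists (x ∷ xs) = sublists xs ++ map (x ∷_) (sublists xs)

  filter∈sublists : {P : Pred A 0ℓ} (P? : Decidable P) (xs : List A) → filter P? xs ∈ sublists xs
  filter∈sublists P? []       = here refl
  filter∈sublists P? (x ∷ xs) with does (P? x)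
  ... | true  = ∈-++⁺ʳ (sublists xs) (∈-map⁺ (x ∷_) (filter∈sublists P? xs))
  ... | false = ∈-++⁺ˡ (filter∈sublists P? xs)

  module _ {P Q : Pred A 0ℓ} (P? : Decidable P) (Q? : Decidable Q) (P⊆Q : ∀ {x} → P x → Q x) where

    length-filter-mono : ∀ xs → length (filter P? xs) ≤ length (filter Q? xs)
    length-filter-mono []       = z≤n
    length-filter-mono (x ∷ xs) with P? x | Q? x
    ... | yes _  | yes _  = s≤s (length-filter-mono xs)
    ... | yes px | no ¬qx = ⊥-elim (¬qx (P⊆Q px))
    ... | no _   | yes _  = ≤-trans (length-filter-mono xs) (n≤1+n _)
    ... | no _   | no _   = length-filter-mono xs

    length-filter-mono-< : ∀ {x} xs → x ∈ xs → Q x → ¬ P x → length (filter P? xs) < length (filter Q? xs)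
    length-filter-mono-< (y ∷ xs) (here refl) qy ¬py with P? y | Q? y
    ... | yes py | _      = ⊥-elim (¬py py)
    ... | no _   | yes _  = s≤s (length-filter-mono xs)
    ... | no _   | no ¬qy = ⊥-elim (¬qy qy)
    length-filter-mono-< (y ∷ xs) (there x∈xs) qx ¬px with P? y | Q? y
    ... | yes _  | yes _  = s≤s (length-filter-mono-< xs x∈xs qx ¬px)
    ... | yes py | no ¬qy = ⊥-elim (¬qy (P⊆Q py))
    ... | no _   | yes _  = ≤-trans (length-filter-mono-< xs x∈xs qx ¬px) (n≤1+n _)
    ... | no _   | no _   = length-filter-mono-< xs x∈xs qx ¬px

  length-filter-∁ : {P : Pred A 0ℓ} (P? : Decidable P) (xs : List A) →
    length (filter P? xs) + length (filter (∁? P?) xs) ≡ length xs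
  length-filter-∁ P? []       = refl
  length-filter-∁ P? (x ∷ xs) with does (P? x)
  ... | true  = cong suc (length-filter-∁ P? xs)
  ... | false = trans (+-suc _ _) (cong suc (length-filter-∁ P? xs))

module _ {A B : Set} where

  AllPairs-map-⊆ : {R : Rel A 0ℓ} {S : Rel B 0ℓ} (f : A → B) {xs ys : List A} → xs ⊆ ys →
    (∀ {x y} → x ∈ ys → y ∈ ys → R x y → S (f x) (f y)) → AllPairs R xs → AllPairs S (map f xs)
  AllPairs-map-⊆ f xs⊆ys R⇒S []         = []
  AllPairs-map-⊆ f xs⊆ys R⇒S (Rx ∷ Rxs) =
    All.map⁺ (All.tabulate λ y∈ → R⇒S (xs⊆ys (here refl)) (xs⊆ys (there y∈)) (All.lookup Rx y∈))
    ∷ AllPairs-map-⊆ f (xs⊆ys ∘′ there) R⇒S Rxs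

module _ {A : Set} where

  removeAt-middle : ∀ (xs : List A) y zs → ∃ λ i → removeAt (xs ++ y ∷ zs) i ≡ xs ++ zs
  removeAt-middle []       y zs = Fin.zero , refl
  removeAt-middle (x ∷ xs) y zs = let i , eq = removeAt-middle xs y zs in Fin.suc i , cong (x ∷_) eq

  ⊆-middle : ∀ (xs : List A) {y zs} → xs ++ zs ⊆ xs ++ y ∷ zs
  ⊆-middle xs m with ∈-++⁻ xs m
  ... | inj₁ m₁ = ∈-++⁺ˡ m₁
  ... | inj₂ m₂ = ∈-++⁺ʳ xs (there m₂)

  ∈-middle : ∀ (xs : List A) {y zs v} → v ∈ xs ++ y ∷ zs → v ≡ y ⊎ v ∈ xs ++ zs
  ∈-middle xs m with ∈-++⁻ xs m
  ... | inj₁ m₁         = inj₂ (∈-++⁺ˡ m₁)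
  ... | inj₂ (here eq)  = inj₁ eq
  ... | inj₂ (there m₂) = inj₂ (∈-++⁺ʳ xs m₂)

indicator : {P : Set} → Dec P → ℕ
indicator P? = if does P? then 1 else 0

indicator-cong : {P Q : Set} → P ⇔ Q → (P? : Dec P) (Q? : Dec Q) → indicator P? ≡ indicator Q?
indicator-cong P⇔Q (yes _) (yes _) = refl
indicator-cong P⇔Q (yes p) (no ¬q) = ⊥-elim (¬q (to P⇔Q p))
indicator-cong P⇔Q (no ¬p) (yes q) = ⊥-elim (¬p (from P⇔Q q))
indicator-cong P⇔Q (no _) (no _) = refl

indicator-inclusion-exclusion : {P Q : Set} (P? : Dec P) (Q? : Dec Q) →
  indicator (P? ⊎-dec Q?) + indicator (P? ×-dec Q?) ≡ indicator P? + indicator Q?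
indicator-inclusion-exclusion (yes _) (yes _) = refl
indicator-inclusion-exclusion (yes _) (no _) = refl
indicator-inclusion-exclusion (no _) (yes _) = refl
indicator-inclusion-exclusion (no _) (no _) = refl

module Representatives {A : Set} {R : Rel A 0ℓ} (R? : Decidable₂ R) where

  representatives : List A → List A
  representatives []       = []
  representatives (x ∷ xs) with any? (R? x) xs
  ... | yes _ = representatives xs
  ... | no _  = x ∷ representatives xs

  classCount : List A → ℕ
  classCount xs = length (representatives xs)

  representatives-⊆ : ∀ xs → representatives xs ⊆ xs
  representatives-⊆ (x ∷ xs) m with any? (R? x) xs
  representatives-⊆ (x ∷ xs) m         | yes _ = there (representatives-⊆ xs m)
  representatives-⊆ (x ∷ xs) (here eq) | no _  = here eq
  representatives-⊆ (x ∷ xs) (there m) | no _  = there (representatives-⊆ xs m)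

  representatives-unrelated : ∀ xs → AllPairs (λ x y → ¬ R x y) (representatives xs)
  representatives-unrelated []       = []
  representatives-unrelated (x ∷ xs) with any? (R? x) xs
  ... | yes _   = representatives-unrelated xs
  ... | no ¬any = All.tabulate (λ m r → ¬any (lose (representatives-⊆ xs m) r))
                  ∷ representatives-unrelated xs

  module _ (R-refl : Reflexive R) (R-trans : Transitive R) where

    representatives-cover : ∀ {x} xs → x ∈ xs → Any (R x) (representatives xs)
    representatives-cover (y ∷ xs) m with any? (R? y) xs
    representatives-cover (y ∷ xs) (here refl) | yes any =
      let z , z∈xs , yRz = find any in Any.map (R-trans yRz) (representatives-cover xs z∈xs)
    representatives-cover (y ∷ xs) (there m)   | yes _ = representatives-cover xs m
    representatives-cover (y ∷ xs) (here refl) | no _  = here R-refl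
    representatives-cover (y ∷ xs) (there m)   | no _  = there (representatives-cover xs m)

    classCount-connected : ∀ {x} xs → x ∈ xs → (∀ {y z} → y ∈ xs → z ∈ xs → R y z) →
      classCount xs ≡ 1
    classCount-connected xs x∈xs related =
      single (representatives xs) (representatives-cover xs x∈xs) (representatives-unrelated xs)
             (representatives-⊆ xs)
      where
      single : ∀ {v} ys → Any (R v) ys → AllPairs (λ y z → ¬ R y z) ys → ys ⊆ xs → length ys ≡ 1
      single (y ∷ [])     _ _                _   = refl
      single (y ∷ z ∷ ys) _ ((¬yRz ∷ _) ∷ _) ys⊆ =
        ⊥-elim (¬yRz (related (ys⊆ (here refl)) (ys⊆ (there (here refl)))))

  classCount-∷ : ∀ x xs → classCount (x ∷ xs) + indicator (any? (R? x) xs) ≡ suc (classCount xs)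
  classCount-∷ x xs with any? (R? x) xs
  ... | yes _ = +-comm _ 1
  ... | no _  = +-comm _ 0

module ClassMerge {A : Set} {R R' : Rel A 0ℓ} (R? : Decidable₂ R) (R'? : Decidable₂ R')
  (R-sym : Symmetric R) (R-trans : Transitive R) {a b : A} (¬aRb : ¬ R a b)
  (R'⇔ : ∀ {x y} → R' x y ⇔ (R x y ⊎ (R x a × R b y) ⊎ (R x b × R a y))) where

  open Representatives using (classCount; classCount-∷)

  Meets : List A → Set
  Meets xs = Any (R a) xs × Any (R b) xs

  meets? : ∀ xs → Dec (Meets xs)
  meets? xs = any? (R? a) xs ×-dec any? (R? b) xs

  private
    R-via : ∀ {x c y} → R x c → R x y ⇔ R c y
    R-via xRc = mk⇔ (R-trans (R-sym xRc)) (R-trans xRc)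

    R'-via-a : ∀ {x y} → R x a → ¬ R x b → R' x y ⇔ (R a y ⊎ R b y)
    R'-via-a xRa ¬xRb = mk⇔
      (λ r → case to R'⇔ r of λ
        { (inj₁ xRy)              → inj₁ (R-trans (R-sym xRa) xRy)
        ; (inj₂ (inj₁ (_ , bRy))) → inj₂ bRy
        ; (inj₂ (inj₂ (xRb , _))) → ⊥-elim (¬xRb xRb) })
      [ (λ aRy → from R'⇔ (inj₁ (R-trans xRa aRy))) , (λ bRy → from R'⇔ (inj₂ (inj₁ (xRa , bRy)))) ]′

    R'-via-b : ∀ {x y} → R x b → ¬ R x a → R' x y ⇔ (R b y ⊎ R a y)
    R'-via-b xRb ¬xRa = mk⇔
      (λ r → case to R'⇔ r of λ
        { (inj₁ xRy)              → inj₁ (R-trans (R-sym xRb) xRy)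
        ; (inj₂ (inj₁ (xRa , _))) → ⊥-elim (¬xRa xRa)
        ; (inj₂ (inj₂ (_ , aRy))) → inj₂ aRy })
      [ (λ bRy → from R'⇔ (inj₁ (R-trans xRb bRy))) , (λ aRy → from R'⇔ (inj₂ (inj₂ (xRb , aRy)))) ]′

    R'-unmoved : ∀ {x y} → ¬ R x a → ¬ R x b → R' x y ⇔ R x y
    R'-unmoved ¬xRa ¬xRb = mk⇔
      (λ r → case to R'⇔ r of λ
        { (inj₁ xRy)              → xRy
        ; (inj₂ (inj₁ (xRa , _))) → ⊥-elim (¬xRa xRa)
        ; (inj₂ (inj₂ (xRb , _))) → ⊥-elim (¬xRb xRb) })
      (λ xRy → from R'⇔ (inj₁ xRy))

    Any-∷-unrelated : ∀ {c x xs} → ¬ R x c → Any (R c) (x ∷ xs) ⇔ Any (R c) xs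
    Any-∷-unrelated ¬xRc = mk⇔ (λ { (here cRx) → ⊥-elim (¬xRc (R-sym cRx)) ; (there p) → p }) there

    meets-∷-a : ∀ {x xs} → R x a → ¬ R x b → Meets (x ∷ xs) ⇔ Any (R b) xs
    meets-∷-a xRa ¬xRb = mk⇔ (λ (_ , p) → to (Any-∷-unrelated ¬xRb) p) (λ p → here (R-sym xRa) , there p)

    meets-∷-b : ∀ {x xs} → R x b → ¬ R x a → Meets (x ∷ xs) ⇔ Any (R a) xs
    meets-∷-b xRb ¬xRa = mk⇔ (λ (p , _) → to (Any-∷-unrelated ¬xRa) p) (λ p → there p , here (R-sym xRb))

    meets-∷-unmoved : ∀ {x xs} → ¬ R x a → ¬ R x b → Meets (x ∷ xs) ⇔ Meets xs
    meets-∷-unmoved ¬xRa ¬xRb = mk⇔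
      (λ (p , q) → to (Any-∷-unrelated ¬xRa) p , to (Any-∷-unrelated ¬xRb) q)
      (λ (p , q) → there p , there q)

    -- x lies in the class of c, one of a and b; d is the other one
    classCount-step-joining : ∀ {x xs c d} → R x c → (∀ {y} → R' x y ⇔ (R c y ⊎ R d y)) →
      Meets xs ⇔ (Any (R c) xs × Any (R d) xs) → Meets (x ∷ xs) ⇔ Any (R d) xs →
      indicator (any? (R'? x) xs) + indicator (meets? xs) ≡ indicator (any? (R? x) xs) + indicator (meets? (x ∷ xs))
    classCount-step-joining {x} {xs} {c} {d} xRc R'⇔cd meets⇔ meets-∷⇔ = begin
      indicator (any? (R'? x) xs) + indicator (meets? xs)
        ≡⟨ cong₂ _+_ (indicator-cong (⇔-trans (Any-cong R'⇔cd) Any-⊎) (any? (R'? x) xs) (C? ⊎-dec D?))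
                     (indicator-cong meets⇔ (meets? xs) (C? ×-dec D?)) ⟩
      indicator (C? ⊎-dec D?) + indicator (C? ×-dec D?)
        ≡⟨ indicator-inclusion-exclusion C? D? ⟩
      indicator C? + indicator D?
        ≡⟨ cong₂ _+_ (indicator-cong (Any-cong (⇔-sym (R-via xRc))) C? (any? (R? x) xs))
                     (indicator-cong (⇔-sym meets-∷⇔) D? (meets? (x ∷ xs))) ⟩
      indicator (any? (R? x) xs) + indicator (meets? (x ∷ xs)) ∎
      where
      open ≡-Reasoning
      C? : Dec (Any (R c) xs)
      C? = any? (R? c) xs
      D? : Dec (Any (R d) xs)
      D? = any? (R? d) xs

  classCount-step : ∀ x xs →
    indicator (any? (R'? x) xs) + indicator (meets? xs) ≡ indicator (any? (R? x) xs) + indicator (meets? (x ∷ xs))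
  classCount-step x xs with R? x a | R? x b
  ... | yes xRa | yes xRb = ⊥-elim (¬aRb (R-trans (R-sym xRa) xRb))
  ... | yes xRa | no ¬xRb =
    classCount-step-joining {xs = xs} xRa (R'-via-a xRa ¬xRb) (mk⇔ id id) (meets-∷-a xRa ¬xRb)
  ... | no ¬xRa | yes xRb =
    classCount-step-joining {xs = xs} xRb (R'-via-b xRb ¬xRa) (mk⇔ swap swap) (meets-∷-b xRb ¬xRa)
  ... | no ¬xRa | no ¬xRb =
    cong₂ _+_ (indicator-cong (Any-cong (R'-unmoved ¬xRa ¬xRb)) (any? (R'? x) xs) (any? (R? x) xs))
              (indicator-cong (⇔-sym (meets-∷-unmoved ¬xRa ¬xRb)) (meets? xs) (meets? (x ∷ xs)))

  classCount-merge : ∀ xs → classCount R? xs ≡ classCount R'? xs + indicator (meets? xs)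
  classCount-merge []       = refl
  classCount-merge (x ∷ xs) = +-cancelʳ-≡ _ _ _ (begin
    classCount R? (x ∷ xs) + indicator (any? (R? x) xs)
      ≡⟨ classCount-∷ R? x xs ⟩
    suc (classCount R? xs)
      ≡⟨ cong suc (classCount-merge xs) ⟩
    suc (classCount R'? xs) + indicator (meets? xs)
      ≡⟨ cong (_+ indicator (meets? xs)) (classCount-∷ R'? x xs) ⟨
    c' + indicator (any? (R'? x) xs) + indicator (meets? xs)
      ≡⟨ +-assoc c' _ _ ⟩
    c' + (indicator (any? (R'? x) xs) + indicator (meets? xs))
      ≡⟨ cong (c' +_) (classCount-step x xs) ⟩
    c' + (indicator (any? (R? x) xs) + indicator (meets? (x ∷ xs)))
      ≡⟨ cong (c' +_) (+-comm (indicator (any? (R? x) xs)) _) ⟩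
    c' + (indicator (meets? (x ∷ xs)) + indicator (any? (R? x) xs))
      ≡⟨ +-assoc c' _ _ ⟨
    c' + indicator (meets? (x ∷ xs)) + indicator (any? (R? x) xs) ∎)
    where
    open ≡-Reasoning
    c' : ℕ
    c' = classCount R'? (x ∷ xs)

  classCount-drop : ∀ {xs} → a ∈ xs → b ∈ xs → Reflexive R → classCount R? xs ≡ suc (classCount R'? xs)
  classCount-drop {xs} a∈xs b∈xs R-refl = begin
    classCount R? xs                           ≡⟨ classCount-merge xs ⟩
    classCount R'? xs + indicator (meets? xs)  ≡⟨ cong (classCount R'? xs +_) meets-once ⟩
    classCount R'? xs + 1                      ≡⟨ +-comm _ 1 ⟩
    suc (classCount R'? xs)                    ∎
    where
    open ≡-Reasoning
    meets-once : indicator (meets? xs) ≡ 1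
    meets-once = indicator-cong (mk⇔ (λ _ → tt) (λ _ → lose a∈xs R-refl , lose b∈xs R-refl)) (meets? xs) (yes tt)

module Reachability {V : Set} (_≟_ : DecidableEquality V) {E : Rel V 0ℓ} (E? : Decidable₂ E)
  (vertices : List V) (vertices-closed : ∀ {x y} → E x y → y ∈ vertices) where

  -- Floyd–Warshall: Via vs x z means there is a path from x to z whose intermediate vertices lie in vs.
  Via : List V → Rel V 0ℓ
  Via []       x z = x ≡ z ⊎ E x z
  Via (v ∷ vs) x z = Via vs x z ⊎ (Via vs x v × Via vs v z)

  via? : ∀ vs → Decidable₂ (Via vs)
  via? []       x z = (x ≟ z) ⊎-dec E? x z
  via? (v ∷ vs) x z = via? vs x z ⊎-dec (via? vs x v ×-dec via? vs v z)

  via⇒star : ∀ vs {x z} → Via vs x z → Star E x z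
  via⇒star []       (inj₁ refl)      = ε
  via⇒star []       (inj₂ xEz)       = return xEz
  via⇒star (v ∷ vs) (inj₁ p)         = via⇒star vs p
  via⇒star (v ∷ vs) (inj₂ (p , q))   = via⇒star vs p ◅◅ via⇒star vs q

  via-edge : ∀ vs {x z} → x ≡ z ⊎ E x z → Via vs x z
  via-edge []       e = e
  via-edge (v ∷ vs) e = inj₁ (via-edge vs e)

  via-trans : ∀ vs {x v z} → v ∈ vs → Via vs x v → Via vs v z → Via vs x z
  via-trans (w ∷ vs) (here refl) p q = inj₂ (ending p , starting q)
    where
    ending : ∀ {x} → Via (w ∷ vs) x w → Via vs x w
    ending (inj₁ p)       = p
    ending (inj₂ (p , _)) = p
    starting : ∀ {z} → Via (w ∷ vs) w z → Via vs w z
    starting (inj₁ q)       = q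
    starting (inj₂ (_ , q)) = q
  via-trans (w ∷ vs) (there v∈vs) (inj₁ p)       (inj₁ q)       = inj₁ (via-trans vs v∈vs p q)
  via-trans (w ∷ vs) (there v∈vs) (inj₁ p)       (inj₂ (q , q')) = inj₂ (via-trans vs v∈vs p q , q')
  via-trans (w ∷ vs) (there v∈vs) (inj₂ (p , p')) (inj₁ q)       = inj₂ (p , via-trans vs v∈vs p' q)
  via-trans (w ∷ vs) (there v∈vs) (inj₂ (p , _)) (inj₂ (_ , q)) = inj₂ (p , q)

  star⇒via : ∀ {x z} → Star E x z → Via vertices x z
  star⇒via ε          = via-edge vertices (inj₁ refl)
  star⇒via (xEy ◅ p) = via-trans vertices (vertices-closed xEy) (via-edge vertices (inj₂ xEy)) (star⇒via p)

  star? : Decidable₂ (Star E)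
  star? x z with via? vertices x z
  ... | yes p = yes (via⇒star vertices p)
  ... | no ¬p = no (¬p ∘′ star⇒via)

module ExtendedGraph {V : Set} (_≟_ : DecidableEquality V) {Vertex : Pred V 0ℓ} (Vertex? : Decidable Vertex)
  (vertices : List V) (vertices-complete : ∀ {x} → Vertex x → x ∈ vertices)
  {Base : Rel V 0ℓ} (Base? : Decidable₂ Base) (Base-sym : Symmetric Base) where

  open import Data.List.Membership.DecPropositional (×-≡-dec _≟_ _≟_) using (_∈?_)

  Edge : List (V × V) → Rel V 0ℓ
  Edge es x y = Vertex x × Vertex y × (Base x y ⊎ (x , y) ∈ es ⊎ (y , x) ∈ es)

  Reach : List (V × V) → Rel V 0ℓ
  Reach es = Star (Edge es)

  edge? : ∀ es → Decidable₂ (Edge es)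
  edge? es x y = Vertex? x ×-dec Vertex? y ×-dec (Base? x y ⊎-dec ((x , y) ∈? es ⊎-dec (y , x) ∈? es))

  edge-sym : ∀ {es} → Symmetric (Edge es)
  edge-sym (vx , vy , inj₁ xBy)         = vy , vx , inj₁ (Base-sym xBy)
  edge-sym (vx , vy , inj₂ (inj₁ xy∈))  = vy , vx , inj₂ (inj₂ xy∈)
  edge-sym (vx , vy , inj₂ (inj₂ yx∈))  = vy , vx , inj₂ (inj₁ yx∈)

  reach-sym : ∀ {es} → Symmetric (Reach es)
  reach-sym = Star.reverse edge-sym

  reach? : ∀ es → Decidable₂ (Reach es)
  reach? es = Reachability.star? _≟_ (edge? es) vertices (λ (_ , vy , _) → vertices-complete vy)

  reach-mono : ∀ {es es'} → es ⊆ es' → ∀ {x y} → Reach es x y → Reach es' x y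
  reach-mono es⊆es' = Star.map λ (vx , vy , e) → vx , vy , Sum.map₂ (Sum.map es⊆es' es⊆es') e

  ReachThrough : V → V → List (V × V) → Rel V 0ℓ
  ReachThrough a b es x y = Reach es x y ⊎ (Reach es x a × Reach es b y) ⊎ (Reach es x b × Reach es a y)

  reach-∷⁻ : ∀ {a b es x y} → Reach ((a , b) ∷ es) x y → ReachThrough a b es x y
  reach-∷⁻ ε = inj₁ ε
  reach-∷⁻ {a} {b} {es} {x} {y} (_◅_ {j = w} e p) = extend e (reach-∷⁻ p)
    where
    old : Edge es x w → ReachThrough a b es w y → ReachThrough a b es x y
    old e = Sum.map (e ◅_) (Sum.map (map₁ (e ◅_)) (map₁ (e ◅_)))
    extend : Edge ((a , b) ∷ es) x w → ReachThrough a b es w y → ReachThrough a b es x y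
    extend (vx , vw , inj₁ xBw)                        = old (vx , vw , inj₁ xBw)
    extend (vx , vw , inj₂ (inj₁ (there xw∈)))         = old (vx , vw , inj₂ (inj₁ xw∈))
    extend (vx , vw , inj₂ (inj₂ (there wx∈)))         = old (vx , vw , inj₂ (inj₂ wx∈))
    extend (_ , _ , inj₂ (inj₁ (here refl))) (inj₁ p)              = inj₂ (inj₁ (ε , p))
    extend (_ , _ , inj₂ (inj₁ (here refl))) (inj₂ (inj₁ (_ , p))) = inj₂ (inj₁ (ε , p))
    extend (_ , _ , inj₂ (inj₁ (here refl))) (inj₂ (inj₂ (_ , p))) = inj₁ p
    extend (_ , _ , inj₂ (inj₂ (here refl))) (inj₁ p)              = inj₂ (inj₂ (ε , p))
    extend (_ , _ , inj₂ (inj₂ (here refl))) (inj₂ (inj₁ (_ , p))) = inj₁ p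
    extend (_ , _ , inj₂ (inj₂ (here refl))) (inj₂ (inj₂ (_ , p))) = inj₂ (inj₂ (ε , p))

  reach-∷⁺ : ∀ {a b es x y} → Vertex a → Vertex b → ReachThrough a b es x y → Reach ((a , b) ∷ es) x y
  reach-∷⁺ va vb (inj₁ p)              = reach-mono there p
  reach-∷⁺ va vb (inj₂ (inj₁ (p , q))) =
    reach-mono there p ◅◅ (va , vb , inj₂ (inj₁ (here refl))) ◅ reach-mono there q
  reach-∷⁺ va vb (inj₂ (inj₂ (p , q))) =
    reach-mono there p ◅◅ (vb , va , inj₂ (inj₂ (here refl))) ◅ reach-mono there q

  components : List (V × V) → ℕ
  components es = Representatives.classCount (reach? es) vertices

  Forest : List (V × V) → Set
  Forest []             = ⊤
  Forest ((a , b) ∷ es) = ¬ Reach es a b × Forest es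

  components-forest : ∀ es → Forest es → All (λ (a , b) → Vertex a × Vertex b) es →
    components [] ≡ length es + components es
  components-forest []             _             _                 = refl
  components-forest ((a , b) ∷ es) (¬ab , forest) ((va , vb) ∷ ends) = begin
    components []                                 ≡⟨ components-forest es forest ends ⟩
    length es + components es                     ≡⟨ cong (length es +_) merged ⟩
    length es + suc (components ((a , b) ∷ es))   ≡⟨ +-suc (length es) _ ⟩
    suc (length es) + components ((a , b) ∷ es)   ∎
    where
    open ≡-Reasoning
    merged : components es ≡ suc (components ((a , b) ∷ es))
    merged = ClassMerge.classCount-drop (reach? es) (reach? ((a , b) ∷ es)) reach-sym _◅◅_ ¬ab
      (mk⇔ reach-∷⁻ (reach-∷⁺ va vb)) (vertices-complete va) (vertices-complete vb) ε

  components-connected : ∀ es {x} → x ∈ vertices →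
    (∀ {y z} → y ∈ vertices → z ∈ vertices → Reach es y z) → components es ≡ 1
  components-connected es = Representatives.classCount-connected (reach? es) ε _◅◅_ vertices

module _ {k : ℕ} where

  open import Data.List.Membership.DecPropositional (Vec.≡-dec {n = k} ℕ._≟_) using (_∈?_)
  open import Data.List.Relation.Binary.Subset.DecPropositional (Vec.≡-dec {n = k} ℕ._≟_) using (_⊆?_)

  ≋-refl : {B : List (Vecℕ k)} → B ≋ B
  ≋-refl z = mk⇔ id id

  ≋-sym : {B B' : List (Vecℕ k)} → B ≋ B' → B' ≋ B
  ≋-sym B≋B' z = ⇔-sym (B≋B' z)

  ≋-trans : {B B' B'' : List (Vecℕ k)} → B ≋ B' → B' ≋ B'' → B ≋ B''
  ≋-trans B≋B' B'≋B'' z = ⇔-trans (B≋B' z) (B'≋B'' z)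

  _≋?_ : (B B' : List (Vecℕ k)) → Dec (B ≋ B')
  B ≋? B' = Dec.map′ ⊆⊇⇒≋ (λ B≋B' → to (B≋B' _) , from (B≋B' _)) (B ⊆? B' ×-dec B' ⊆? B)
    where
    ⊆⊇⇒≋ : B ⊆ B' × B' ⊆ B → B ≋ B'
    ⊆⊇⇒≋ (B⊆B' , B'⊆B) z = mk⇔ B⊆B' B'⊆B

  ≋-Invariant : (List (Vecℕ k) → Set) → Set
  ≋-Invariant P = ∀ {B B'} → B ≋ B' → P B → P B'

  numberOf : {P : List (Vecℕ k) → Set} → Decidable P → ≋-Invariant P →
    (U : List (Vecℕ k)) → (∀ {B} → P B → B ⊆ U) → ∃ (NumberOf P)
  numberOf {P} P? P-inv U bounded =
    length L , L , refl ,
    All.tabulate (λ m → proj₂ (∈-filter⁻ P? {xs = sublists U} (representatives-⊆ candidates m))) ,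
    representatives-unrelated candidates ,
    cover
    where
    open Representatives _≋?_
    candidates : List (List (Vecℕ k))
    candidates = filter P? (sublists U)
    L : List (List (Vecℕ k))
    L = representatives candidates
    cover : ∀ B → P B → Any (B ≋_) L
    cover B pB = Any.map (≋-trans B≋S) (representatives-cover ≋-refl ≋-trans candidates S∈candidates)
      where
      S : List (Vecℕ k)
      S = filter (_∈? B) U
      B≋S : B ≋ S
      B≋S z = mk⇔ (λ m → ∈-filter⁺ (_∈? B) (bounded pB m) m)
                  (λ m → proj₂ (∈-filter⁻ (_∈? B) {xs = U} m))
      S∈candidates : S ∈ candidates
      S∈candidates = ∈-filter⁺ P? (filter∈sublists (_∈? B) U) (P-inv B≋S pB)

  numberOf-split : {P Q : List (Vecℕ k) → Set} {n : ℕ} → NumberOf P n → Decidable Q → ≋-Invariant Q →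
    ∃₂ λ a b → NumberOf (λ B → P B × Q B) a × NumberOf (λ B → P B × ¬ Q B) b × a + b ≡ n
  numberOf-split {P} (L , refl , all , distinct , cover) Q? Q-inv =
    _ , _ , restrict Q? Q-inv , restrict (∁? Q?) (λ B≋B' ¬qB qB' → ¬qB (Q-inv (≋-sym B≋B') qB')) ,
    length-filter-∁ Q? L
    where
    restrict : {Q' : List (Vecℕ k) → Set} (Q'? : Decidable Q') → ≋-Invariant Q' →
      NumberOf (λ B → P B × Q' B) (length (filter Q'? L))
    restrict Q'? Q'-inv =
      filter Q'? L , refl ,
      All.tabulate (λ m → let m' , q = ∈-filter⁻ Q'? m in All.lookup all m' , q) ,
      AllPairs.filter⁺ Q'? distinct ,
      λ B (pB , qB) → let X , X∈L , B≋X = find (cover B pB) in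
        lose (∈-filter⁺ Q'? X∈L (Q'-inv B≋X qB)) B≋X

  numberOf-union : {P Q R : List (Vecℕ k) → Set} {m n : ℕ} → NumberOf P m → NumberOf Q n →
    (∀ {B B'} → P B → Q B' → ¬ (B ≋ B')) →
    (∀ {B} → R B → P B ⊎ Q B) → (∀ {B} → P B → R B) → (∀ {B} → Q B → R B) → NumberOf R (m + n)
  numberOf-union (L₁ , refl , all₁ , distinct₁ , cover₁) (L₂ , refl , all₂ , distinct₂ , cover₂)
                 disjoint R⊆ P⊆ Q⊆ =
    L₁ ++ L₂ , length-++ L₁ ,
    All.++⁺ (All.map P⊆ all₁) (All.map Q⊆ all₂) ,
    AllPairs.++⁺ distinct₁ distinct₂ (All.map (λ pB → All.map (disjoint pB) all₂) all₁) ,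
    λ B rB → [ (λ pB → Any.++⁺ˡ (cover₁ B pB)) , (λ qB → Any.++⁺ʳ L₁ (cover₂ B qB)) ]′ (R⊆ rB)

zeros : ∀ {k} → Vecℕ k
zeros = replicate _ 0

_+e_ : ∀ {k} → Vecℕ k → Fin k → Vecℕ k
z +e i = updateAt z i suc

unit : ∀ {k} → Fin k → Vecℕ k
unit i = zeros +e i

module _ {k : ℕ} where

  ⊞-assoc : (x y z : Vecℕ k) → (x ⊞ y) ⊞ z ≡ x ⊞ (y ⊞ z)
  ⊞-assoc = Vec.zipWith-assoc +-assoc

  ⊞-identityʳ : (x : Vecℕ k) → x ⊞ zeros ≡ x
  ⊞-identityʳ = Vec.zipWith-identityʳ +-identityʳ

  lookup-⊞ : (x y : Vecℕ k) (i : Fin k) → lookup (x ⊞ y) i ≡ lookup x i + lookup y i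
  lookup-⊞ x y i = Vec.lookup-zipWith _+_ i x y

  lookup-+e : (x : Vecℕ k) (i : Fin k) → lookup (x +e i) i ≡ suc (lookup x i)
  lookup-+e x i = Vec.lookup∘updateAt i x

  lookup-−e : (x : Vecℕ k) (i : Fin k) → lookup (x −e i) i ≡ pred (lookup x i)
  lookup-−e x i = Vec.lookup∘updateAt i x

  lookup-−e-≢ : (x : Vecℕ k) {i j : Fin k} → i ≢ j → lookup (x −e i) j ≡ lookup x j
  lookup-−e-≢ x i≢j = Vec.lookup∘updateAt′ _ _ (i≢j ∘ sym) x

  −e-+e : (x : Vecℕ k) (i : Fin k) → InSupp x i → (x −e i) +e i ≡ x
  −e-+e x i 0<xᵢ = trans (Vec.updateAt-updateAt i x) (Vec.updateAt-id-local i x (suc-pred 0<xᵢ))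
    where
    suc-pred : ∀ {n} → 0 < n → suc (pred n) ≡ n
    suc-pred (s≤s _) = refl

  +e-−e : (x : Vecℕ k) (i : Fin k) → (x +e i) −e i ≡ x
  +e-−e x i = trans (Vec.updateAt-updateAt i x) (Vec.updateAt-id i x)

  −e-injective : (x y : Vecℕ k) (i : Fin k) → InSupp x i → InSupp y i → x −e i ≡ y −e i → x ≡ y
  −e-injective x y i xᵢ>0 yᵢ>0 eq = begin
    x                ≡⟨ −e-+e x i xᵢ>0 ⟨
    (x −e i) +e i    ≡⟨ cong (_+e i) eq ⟩
    (y −e i) +e i    ≡⟨ −e-+e y i yᵢ>0 ⟩
    y                ∎
    where open ≡-Reasoning

  +e-supp : (x : Vecℕ k) (i : Fin k) → InSupp (x +e i) i
  +e-supp x i = subst (0 <_) (sym (lookup-+e x i)) (s≤s z≤n)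

⊞-unit : ∀ {k} (x : Vecℕ k) (i : Fin k) → x ⊞ unit i ≡ x +e i
⊞-unit (a ∷ x) Fin.zero    = cong₂ _∷_ (+-comm a 1) (⊞-identityʳ x)
⊞-unit (a ∷ x) (Fin.suc i) = cong₂ _∷_ (+-identityʳ a) (⊞-unit x i)

supp-empty⇒zeros : ∀ {k} (u : Vecℕ k) → (∀ i → ¬ InSupp u i) → u ≡ zeros
supp-empty⇒zeros []          _       = refl
supp-empty⇒zeros (zero ∷ u)  ¬supp   = cong (0 ∷_) (supp-empty⇒zeros u (¬supp ∘ Fin.suc))
supp-empty⇒zeros (suc _ ∷ u) ¬supp   = ⊥-elim (¬supp Fin.zero (s≤s z≤n))

box : ∀ {k} → (Fin k → ℕ) → List (Vecℕ k)
box {zero}  b = [ [] ]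
box {suc k} b = concatMap (λ x → map (x ∷_) (box (b ∘ Fin.suc))) (upTo (b Fin.zero))

∈-box : ∀ {k} (b : Fin k → ℕ) (z : Vecℕ k) → (∀ i → lookup z i < b i) → z ∈ box b
∈-box b []      _   = here refl
∈-box b (x ∷ z) z<b =
  ∈-concatMap⁺ (λ x → map (x ∷_) (box (b ∘ Fin.suc)))
    (lose (∈-upTo⁺ (z<b Fin.zero)) (∈-map⁺ (x ∷_) (∈-box (b ∘ Fin.suc) z (z<b ∘ Fin.suc))))

module NilSemigroupProperties (N : NilSemigroup) where

  open NilSemigroup N

  ⊕-commutativeSemigroup : CommutativeSemigroup 0ℓ 0ℓ
  ⊕-commutativeSemigroup = record
    { _≈_ = _≡_
    ; _∙_ = _⊕_
    ; isCommutativeSemigroup = record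
      { isSemigroup = record
        { isMagma = record { isEquivalence = isEquivalence ; ∙-cong = cong₂ _⊕_ }
        ; assoc = assoc
        }
      ; comm = comm
      }
    }

  open import Algebra.Properties.CommutativeSemigroup ⊕-commutativeSemigroup public using (interchange)

  identityʳ : ∀ a → a ⊕ 𝟘 ≡ a
  identityʳ a = trans (comm a 𝟘) (identity a)

  absorbˡ : ∀ a → ∞ ⊕ a ≡ ∞
  absorbˡ a = trans (comm ∞ a) (absorb a)

  ⊕-≢∞ˡ : ∀ {a b} → a ⊕ b ≢ ∞ → a ≢ ∞
  ⊕-≢∞ˡ {a} {b} ab≢∞ a≡∞ = ab≢∞ (trans (cong (_⊕ b) a≡∞) (absorbˡ b))

  ⊕-≢∞ʳ : ∀ {a b} → a ⊕ b ≢ ∞ → b ≢ ∞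
  ⊕-≢∞ʳ {a} {b} ab≢∞ b≡∞ = ab≢∞ (trans (cong (a ⊕_) b≡∞) (absorb a))

  •-+ : ∀ m n a → (m + n) • a ≡ (m • a) ⊕ (n • a)
  •-+ zero    n a = sym (identity _)
  •-+ (suc m) n a = trans (cong (a ⊕_) (•-+ m n a)) (sym (assoc a _ _))

  •-⊕ : ∀ n a b → n • (a ⊕ b) ≡ (n • a) ⊕ (n • b)
  •-⊕ zero    a b = sym (identity 𝟘)
  •-⊕ (suc n) a b = trans (cong ((a ⊕ b) ⊕_) (•-⊕ n a b)) (interchange a b _ _)

  •-𝟘 : ∀ n → n • 𝟘 ≡ 𝟘
  •-𝟘 zero    = refl
  •-𝟘 (suc n) = trans (identity _) (•-𝟘 n)

  •-∞-mono : ∀ {m n a} → m ≤ n → m • a ≡ ∞ → n • a ≡ ∞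
  •-∞-mono {m} {n} {a} m≤n m•a≡∞ = begin
    n • a                       ≡⟨ cong (_• a) (m+[n∸m]≡n m≤n) ⟨
    (m + (n ∸ m)) • a           ≡⟨ •-+ m (n ∸ m) a ⟩
    (m • a) ⊕ ((n ∸ m) • a)     ≡⟨ cong (_⊕ _) m•a≡∞ ⟩
    ∞ ⊕ ((n ∸ m) • a)           ≡⟨ absorbˡ _ ⟩
    ∞                           ∎
    where open ≡-Reasoning

  module _ (𝟘≢∞ : 𝟘 ≢ ∞) where

    ⊕-≢𝟘 : ∀ {c} y → c ≢ 𝟘 → c ⊕ y ≢ 𝟘
    ⊕-≢𝟘 {c} y c≢𝟘 cy≡𝟘 = 𝟘≢∞ (begin
      𝟘                    ≡⟨ •-𝟘 n ⟨
      n • 𝟘                ≡⟨ cong (n •_) cy≡𝟘 ⟨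
      n • (c ⊕ y)          ≡⟨ •-⊕ n c y ⟩
      (n • c) ⊕ (n • y)    ≡⟨ cong (_⊕ _) (proj₂ (nilpotent c c≢𝟘)) ⟩
      ∞ ⊕ (n • y)          ≡⟨ absorbˡ _ ⟩
      ∞                    ∎)
      where
      open ≡-Reasoning
      n : ℕ
      n = proj₁ (nilpotent c c≢𝟘)

    -- b = b ⊕ s with s nonzero forces b = b ⊕ n•s = ∞
    fixed⇒∞ : ∀ {b s} → b ⊕ s ≡ b → s ≢ 𝟘 → b ≡ ∞
    fixed⇒∞ {b} {s} bs≡b s≢𝟘 = begin
      b                ≡⟨ absorbs n ⟨
      b ⊕ (n • s)      ≡⟨ cong (b ⊕_) (proj₂ (nilpotent s s≢𝟘)) ⟩
      b ⊕ ∞            ≡⟨ absorb b ⟩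
      ∞                ∎
      where
      open ≡-Reasoning
      n : ℕ
      n = proj₁ (nilpotent s s≢𝟘)
      absorbs : ∀ m → b ⊕ (m • s) ≡ b
      absorbs zero    = identityʳ b
      absorbs (suc m) = trans (sym (assoc b s _)) (trans (cong (_⊕ (m • s)) bs≡b) (absorbs m))

module FactorizationProperties (N : NilSemigroup) {k : ℕ} (A : AtomEnum N k) where

  open NilSemigroup N
  open AtomEnum A
  open Factorization N A
  open NilSemigroupProperties N

  φ'-⊞ : ∀ {m} (z w : Vecℕ m) f → φ' (z ⊞ w) f ≡ φ' z f ⊕ φ' w f
  φ'-⊞ []      []      f = sym (identity 𝟘)
  φ'-⊞ (x ∷ z) (y ∷ w) f = trans (cong₂ _⊕_ (•-+ x y (f Fin.zero)) (φ'-⊞ z w _)) (interchange _ _ _ _)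

  φ'-zeros : ∀ {m} f → φ' (zeros {m}) f ≡ 𝟘
  φ'-zeros {zero}  f = refl
  φ'-zeros {suc m} f = trans (identity _) (φ'-zeros {m} _)

  φ'-+e : ∀ {m} (z : Vecℕ m) i f → φ' (z +e i) f ≡ φ' z f ⊕ f i
  φ'-+e (x ∷ z) Fin.zero    f = trans (assoc _ _ _) (comm _ _)
  φ'-+e (x ∷ z) (Fin.suc i) f = trans (cong (_ ⊕_) (φ'-+e z i _)) (sym (assoc _ _ _))

  φ'-split : ∀ {m} (z : Vecℕ m) i f → ∃ λ r → φ' z f ≡ (lookup z i • f i) ⊕ r
  φ'-split (x ∷ z) Fin.zero    f = _ , refl
  φ'-split (x ∷ z) (Fin.suc i) f =
    let r , eq = φ'-split z i (f ∘ Fin.suc) in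
    (x • f Fin.zero) ⊕ r ,
    trans (cong (_ ⊕_) eq) (trans (sym (assoc _ _ _)) (trans (cong (_⊕ r) (comm _ _)) (assoc _ _ _)))

  φ-⊞ : ∀ z w → φ (z ⊞ w) ≡ φ z ⊕ φ w
  φ-⊞ z w = φ'-⊞ z w atom

  φ-zeros : φ zeros ≡ 𝟘
  φ-zeros = φ'-zeros atom

  φ-+e : ∀ z i → φ (z +e i) ≡ φ z ⊕ atom i
  φ-+e z i = φ'-+e z i atom

  φ-−e : ∀ z i → InSupp z i → φ (z −e i) ⊕ atom i ≡ φ z
  φ-−e z i zᵢ>0 = trans (sym (φ-+e (z −e i) i)) (cong φ (−e-+e z i zᵢ>0))

  φ-unit : ∀ i → φ (unit i) ≡ atom i
  φ-unit i = trans (φ-+e zeros i) (trans (cong (_⊕ atom i) φ-zeros) (identity _))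

  atom≢𝟘 : ∀ i → atom i ≢ 𝟘
  atom≢𝟘 i = proj₁ (isAtom i)

  cancel-atom : ∀ {a b} i → a ⊕ atom i ≡ b ⊕ atom i → a ⊕ atom i ≢ ∞ → a ≡ b
  cancel-atom {a} {b} i eq ≢∞ =
    partlyCancel (atom i) a b (trans (comm _ _) (trans eq (comm _ _))) (λ h → ≢∞ (trans (comm _ _) h))

  nilIndex : Fin k → ℕ
  nilIndex i = proj₁ (nilpotent (atom i) (atom≢𝟘 i))

  nilIndex-∞ : ∀ i → nilIndex i • atom i ≡ ∞
  nilIndex-∞ i = proj₂ (nilpotent (atom i) (atom≢𝟘 i))

  coordinate-bound : ∀ z → φ z ≢ ∞ → ∀ i → lookup z i < nilIndex i
  coordinate-bound z φz≢∞ i with lookup z i <? nilIndex i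
  ... | yes zᵢ<n = zᵢ<n
  ... | no zᵢ≮n = ⊥-elim (φz≢∞ (begin
    φ z                        ≡⟨ proj₂ split ⟩
    (lookup z i • atom i) ⊕ r  ≡⟨ cong (_⊕ r) (•-∞-mono (≮⇒≥ zᵢ≮n) (nilIndex-∞ i)) ⟩
    ∞ ⊕ r                      ≡⟨ absorbˡ r ⟩
    ∞                          ∎))
    where
    open ≡-Reasoning
    split : ∃ λ r → φ z ≡ (lookup z i • atom i) ⊕ r
    split = φ'-split z i atom
    r : Carrier
    r = proj₁ split

  ∈-box-nilIndex : ∀ z → φ z ≢ ∞ → z ∈ box nilIndex
  ∈-box-nilIndex z φz≢∞ = ∈-box nilIndex z (coordinate-bound z φz≢∞)

  -- existence of factorizations, by induction on the number of elements that are not multiples of a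
  module _ (𝟘≢∞ : 𝟘 ≢ ∞) where

    Divides : Carrier → Carrier → Set
    Divides a x = ∃ λ y → a ⊕ y ≡ x

    divides? : ∀ a x → Dec (Divides a x)
    divides? a x with any? (λ y → (a ⊕ y) ≟ x) elements
    ... | yes found = yes (let y , _ , ay≡x = find found in y , ay≡x)
    ... | no ¬found = no λ (y , ay≡x) → ¬found (lose (complete y) ay≡x)

    nonMultiples : Carrier → ℕ
    nonMultiples a = length (filter (λ x → ¬? (divides? a x)) elements)

    nonMultiples-< : ∀ {a b c} → b ⊕ c ≡ a → c ≢ 𝟘 → a ≢ ∞ → nonMultiples b < nonMultiples a
    nonMultiples-< {a} {b} {c} bc≡a c≢𝟘 a≢∞ =
      length-filter-mono-< (λ x → ¬? (divides? b x)) (λ x → ¬? (divides? a x))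
        (λ ¬b∣x a∣x → ¬b∣x (b∣ a∣x)) elements (complete b) ¬a∣b (λ ¬b∣b → ¬b∣b (𝟘 , identityʳ b))
      where
      b∣ : ∀ {x} → Divides a x → Divides b x
      b∣ (y , ay≡x) = c ⊕ y , trans (sym (assoc b c y)) (trans (cong (_⊕ y) bc≡a) ay≡x)
      ¬a∣b : ¬ Divides a b
      ¬a∣b (y , ay≡b) =
        a≢∞ (trans (sym bc≡a) (trans (cong (_⊕ c) b≡∞) (absorbˡ c)))
        where
        b≡∞ : b ≡ ∞
        b≡∞ = fixed⇒∞ 𝟘≢∞ (trans (sym (assoc b c y)) (trans (cong (_⊕ y) bc≡a) ay≡b))
                          (⊕-≢𝟘 𝟘≢∞ y c≢𝟘)

    Decomposable : Carrier → Set
    Decomposable a = Σ Carrier λ b → Σ Carrier λ c → b ≢ 𝟘 × c ≢ 𝟘 × a ≡ b ⊕ c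

    decomposable? : ∀ a → Dec (Decomposable a)
    decomposable? a
      with any? (λ b → any? (λ c → (¬? (b ≟ 𝟘) ×-dec ¬? (c ≟ 𝟘)) ×-dec (a ≟ (b ⊕ c))) elements)
                elements
    ... | yes found =
      let b , _ , found' = find found ; c , _ , (b≢𝟘 , c≢𝟘) , a≡bc = find found' in
      yes (b , c , b≢𝟘 , c≢𝟘 , a≡bc)
    ... | no ¬found = no λ (b , c , b≢𝟘 , c≢𝟘 , a≡bc) →
      ¬found (lose (complete b) (lose (complete c) ((b≢𝟘 , c≢𝟘) , a≡bc)))

    factorization-acc : ∀ a → Acc _<_ (nonMultiples a) → a ≢ ∞ → ∃ (Z a)
    factorization-acc a (acc smaller) a≢∞ with a ≟ 𝟘
    ... | yes a≡𝟘 = zeros , trans φ-zeros (sym a≡𝟘)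
    ... | no a≢𝟘 with decomposable? a
    ...   | no indecomposable =
      let i , atomᵢ≡a = allAtoms a (a≢𝟘 , a≢∞ , indecomposable) in unit i , trans (φ-unit i) atomᵢ≡a
    ...   | yes (b , c , b≢𝟘 , c≢𝟘 , a≡bc) =
      let bc≢∞ = a≢∞ ∘ trans a≡bc
          zb , φzb≡b = factorization-acc b (smaller (nonMultiples-< (sym a≡bc) c≢𝟘 a≢∞))
                                         (⊕-≢∞ˡ bc≢∞)
          zc , φzc≡c = factorization-acc c (smaller (nonMultiples-< (trans (comm c b) (sym a≡bc)) b≢𝟘 a≢∞))
                                         (⊕-≢∞ʳ bc≢∞)
      in zb ⊞ zc , trans (φ-⊞ zb zc) (trans (cong₂ _⊕_ φzb≡b φzc≡c) (sym a≡bc))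

    factorization : ∀ a → a ≢ ∞ → ∃ (Z a)
    factorization a = factorization-acc a (<-wellFounded _)

module OuterBettiDecidable (N : NilSemigroup) {k : ℕ} (A : AtomEnum N k) where

  open NilSemigroup N
  open AtomEnum A
  open Factorization N A
  open Betti N A using (OuterBetti)
  open FactorizationProperties N A

  open import Data.List.Membership.DecPropositional (Vec.≡-dec {n = k} ℕ._≟_) using (_∈?_)

  inSupp? : ∀ (z : Vecℕ k) i → Dec (InSupp z i)
  inSupp? z i = 0 <? lookup z i

  suppMeet? : ∀ z z' → Dec (SuppMeet z z')
  suppMeet? z z' = Fin.any? (λ i → inSupp? z i ×-dec inSupp? z' i)

  inSuppSet? : ∀ B i → Dec (InSuppSet B i)
  inSuppSet? B i = Dec.map′ find (λ (z , z∈B , zᵢ>0) → lose z∈B zᵢ>0) (any? (λ z → inSupp? z i) B)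

  minusE? : ∀ B i y → Dec (MinusE B i y)
  minusE? B i y = Dec.map′ find (λ (z , z∈B , zᵢ>0 , y≡) → lose z∈B (zᵢ>0 , y≡))
    (any? (λ z → inSupp? z i ×-dec Vec.≡-dec {n = k} ℕ._≟_ y (z −e i)) B)

  MinusEquals : List (Vecℕ k) → Fin k → Carrier → Set
  MinusEquals B i q = ∀ y → MinusE B i y ⇔ Z q y

  -- Z(q) is finite for q ≢ ∞, so the equality of the two sets can be checked on box nilIndex.
  minusEquals? : ∀ B i q → q ≢ ∞ → Dec (MinusEquals B i q)
  minusEquals? B i q q≢∞ =
    Dec.map′ both split
      (all? (λ z → inSupp? z i →-dec (φ (z −e i) ≟ q)) B ×-dec
       all? (λ y → (φ y ≟ q) →-dec minusE? B i y) (box nilIndex))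
    where
    Lowered : Set
    Lowered = All (λ z → InSupp z i → φ (z −e i) ≡ q) B
    Lifted : Set
    Lifted = All (λ y → φ y ≡ q → MinusE B i y) (box nilIndex)
    both : Lowered × Lifted → MinusEquals B i q
    both (lowered , lifted) y = mk⇔
      (λ (z , z∈B , zᵢ>0 , y≡) → subst (Z q) (sym y≡) (All.lookup lowered z∈B zᵢ>0))
      (λ φy≡q → All.lookup lifted (∈-box-nilIndex y (q≢∞ ∘ trans (sym φy≡q))) φy≡q)
    split : MinusEquals B i q → Lowered × Lifted
    split eq = All.tabulate (λ z∈B zᵢ>0 → to (eq _) (_ , z∈B , zᵢ>0 , refl)) ,
               All.tabulate (λ _ φy≡q → from (eq _) φy≡q)

  minusEquals-value : ∀ {B : List (Vecℕ k)} {i q z} → z ∈ B → InSupp z i → MinusEquals B i q →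
    φ (z −e i) ≡ q
  minusEquals-value z∈B zᵢ>0 eq = to (eq _) (_ , z∈B , zᵢ>0 , refl)

  minusE-⊆ : ∀ {B B' : List (Vecℕ k)} {i y} → B ⊆ B' → MinusE B i y → MinusE B' i y
  minusE-⊆ B⊆B' (z , z∈B , zᵢ>0 , y≡) = z , B⊆B' z∈B , zᵢ>0 , y≡

  minusEquals-invariant : ∀ {B B' : List (Vecℕ k)} {i q} → B ≋ B' → MinusEquals B i q → MinusEquals B' i q
  minusEquals-invariant B≋B' eq y =
    mk⇔ (to (eq y) ∘ minusE-⊆ (from (B≋B' _))) (minusE-⊆ (to (B≋B' _)) ∘ from (eq y))

  minusEquals-φ : ∀ {B i q w} → MinusEquals B i q → w ∈ B → InSupp w i → φ w ≡ q ⊕ atom i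
  minusEquals-φ {i = i} {w = w} eq w∈B wᵢ>0 =
    trans (sym (φ-−e w i wᵢ>0)) (cong (_⊕ atom i) (minusEquals-value w∈B wᵢ>0 eq))

  WalkEdge : List (Vecℕ k) → Vecℕ k → Vecℕ k → Set
  WalkEdge B x y = y ∈ B × SuppMeet x y

  walk⇒star : ∀ {B : List (Vecℕ k)} {x z} → Walk B x z → Star (WalkEdge B) x z
  walk⇒star here            = ε
  walk⇒star (next y∈B m w) = (y∈B , m) ◅ walk⇒star w

  star⇒walk : ∀ {B : List (Vecℕ k)} {x z} → Star (WalkEdge B) x z → Walk B x z
  star⇒walk ε                = here
  star⇒walk ((y∈B , m) ◅ w) = next y∈B m (star⇒walk w)

  walk? : ∀ B x z → Dec (Walk B x z)
  walk? B x z = Dec.map′ star⇒walk walk⇒star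
    (Reachability.star? (Vec.≡-dec {n = k} ℕ._≟_) (λ x y → (y ∈? B) ×-dec suppMeet? x y) B proj₁ x z)

  walk-⊆ : ∀ {B B' : List (Vecℕ k)} → B ⊆ B' → ∀ {x y} → Walk B x y → Walk B' x y
  walk-⊆ B⊆B' here            = here
  walk-⊆ B⊆B' (next y∈B m w) = next (B⊆B' y∈B) m (walk-⊆ B⊆B' w)

  connected? : ∀ B → Dec (Connected B)
  connected? []      = no λ { ((_ , ()) , _) }
  connected? (z ∷ B) = Dec.map′
    (λ all-walks → (z , here refl) , λ x y x∈ y∈ → All.lookup (All.lookup all-walks x∈) y∈)
    (λ (_ , walks) → All.tabulate λ x∈ → All.tabulate λ y∈ → walks _ _ x∈ y∈)
    (all? (λ x → all? (λ y → walk? (z ∷ B) x y) (z ∷ B)) (z ∷ B))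

  connected-invariant : ∀ {B B' : List (Vecℕ k)} → B ≋ B' → Connected B → Connected B'
  connected-invariant B≋B' ((z , z∈B) , walks) =
    (z , to (B≋B' z) z∈B) ,
    λ x y x∈ y∈ → walk-⊆ (to (B≋B' _)) (walks x y (from (B≋B' x) x∈) (from (B≋B' y) y∈))

  module _ {ZInf : Vecℕ k → Set} {NonNil : Carrier → Set} {B : List (Vecℕ k)}
           (B-outer : IsOuterBetti ZInf NonNil Z B) where

    φ-constant-on-walks : ∀ {x y} → x ∈ B → Walk B x y → φ y ≡ φ x
    φ-constant-on-walks x∈B here = refl
    φ-constant-on-walks x∈B (next w∈B (i , xᵢ>0 , wᵢ>0) walk) =
      trans (φ-constant-on-walks w∈B walk)
            (trans (minusEquals-φ eq w∈B wᵢ>0) (sym (minusEquals-φ eq x∈B xᵢ>0)))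
      where
      eq : MinusEquals B i (proj₁ (proj₁ (proj₂ B-outer) i (_ , x∈B , xᵢ>0)))
      eq = proj₂ (proj₂ (proj₁ (proj₂ B-outer) i (_ , x∈B , xᵢ>0)))

    φ-constant : ∀ {x y} → x ∈ B → y ∈ B → φ y ≡ φ x
    φ-constant x∈B y∈B = φ-constant-on-walks x∈B (proj₂ (proj₂ (proj₂ B-outer)) _ _ x∈B y∈B)

  MinusCondition : List (Vecℕ k) → Fin k → Set
  MinusCondition B i = InSuppSet B i → Σ Carrier λ q → q ≢ ∞ × MinusEquals B i q

  -- the only candidate for q is φ(z - e_i) for any z ∈ B with i in its support
  minusCondition? : ∀ B i → Dec (MinusCondition B i)
  minusCondition? B i with inSuppSet? B i
  ... | no ¬supp = yes (⊥-elim ∘ ¬supp)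
  ... | yes supp@(z , z∈B , zᵢ>0) with φ (z −e i) ≟ ∞
  ...   | yes φ≡∞ = no λ cond →
    let q , q≢∞ , eq = cond supp in q≢∞ (trans (sym (minusEquals-value z∈B zᵢ>0 eq)) φ≡∞)
  ...   | no φ≢∞ = Dec.map′ (λ eq _ → _ , φ≢∞ , eq)
    (λ cond → let q , _ , eq = cond supp in subst (MinusEquals B i) (sym (minusEquals-value z∈B zᵢ>0 eq)) eq)
    (minusEquals? B i _ φ≢∞)

  outerBetti? : ∀ B → Dec (OuterBetti B)
  outerBetti? B = Dec.map′
    (λ ((zinf , cond) , conn) → (λ z z∈B → All.lookup zinf z∈B) , cond , conn)
    (λ (zinf , cond , conn) → (All.tabulate (zinf _) , cond) , conn)
    ((all? (λ z → φ z ≟ ∞) B ×-dec Fin.all? (minusCondition? B)) ×-dec connected? B)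

  outerBetti-invariant : ≋-Invariant OuterBetti
  outerBetti-invariant B≋B' (zinf , cond , conn) =
    (λ z z∈B' → zinf z (from (B≋B' z) z∈B')) ,
    (λ i (z , z∈B' , zᵢ>0) →
      let q , q≢∞ , eq = cond i (z , from (B≋B' z) z∈B' , zᵢ>0) in
      q , q≢∞ , minusEquals-invariant B≋B' eq) ,
    connected-invariant B≋B' conn

  -- an element of an outer Betti element is one step above a non-nil factorization
  outerBetti-bounded : ∀ {B} → OuterBetti B → B ⊆ box (suc ∘ nilIndex)
  outerBetti-bounded {B} (_ , cond , _) {z} z∈B with Fin.any? (inSupp? z)
  ... | no ¬supp = ∈-box _ z (λ i → s≤s (≤-trans (≮⇒≥ (λ zᵢ>0 → ¬supp (i , zᵢ>0))) z≤n))
  ... | yes (i , zᵢ>0) = ∈-box _ z bounded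
    where
    lowered-bound : ∀ j → lookup (z −e i) j < nilIndex j
    lowered-bound = let _ , q≢∞ , eq = cond i (z , z∈B , zᵢ>0) in
      coordinate-bound (z −e i) (λ φ≡∞ → q≢∞ (trans (sym (minusEquals-value z∈B zᵢ>0 eq)) φ≡∞))
    bounded : ∀ j → lookup z j < suc (nilIndex j)
    bounded j with i Fin.≟ j
    ... | yes refl = pred-< (subst (_< nilIndex i) (lookup-−e z i) (lowered-bound i))
      where
      pred-< : ∀ {n m} → pred n < m → n < suc m
      pred-< {zero}  _ = s≤s z≤n
      pred-< {suc n} p = s≤s p
    ... | no i≢j = ≤-trans (subst (_< nilIndex j) (lookup-−e-≢ z i≢j) (lowered-bound j)) (n≤1+n _)

  numberOfOuterBetti : ∃ (NumberOf OuterBetti)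
  numberOfOuterBetti = numberOf outerBetti? outerBetti-invariant (box (suc ∘ nilIndex)) outerBetti-bounded

gen-⊞ : ∀ {k} {ρ : List (Trade k)} {x y} → Gen ρ x y → ∀ u → Gen ρ (x ⊞ u) (y ⊞ u)
gen-⊞ {ρ = ρ} (step {a} {b} ab∈ρ w) u =
  subst₂ (Gen ρ) (sym (⊞-assoc a w u)) (sym (⊞-assoc b w u)) (step ab∈ρ (w ⊞ u))
gen-⊞ Gen.refl          u = Gen.refl
gen-⊞ (Gen.sym g)       u = Gen.sym (gen-⊞ g u)
gen-⊞ (Gen.trans g g')  u = Gen.trans (gen-⊞ g u) (gen-⊞ g' u)

gen-sound : ∀ {k} {C : Set} {φ : Vecℕ k → C} {ρ} → Generates φ ρ →
  ∀ {x y} → Gen ρ x y → φ x ≡ φ y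
gen-sound ρ-generates g = to (ρ-generates _ _) g

gen-complete : ∀ {k} {C : Set} {φ : Vecℕ k → C} {ρ} → Generates φ ρ →
  ∀ {x y} → φ x ≡ φ y → Gen ρ x y
gen-complete ρ-generates eq = from (ρ-generates _ _) eq

gen-trade : ∀ {k} {ρ : List (Trade k)} {a b} → (a , b) ∈ ρ → Gen ρ a b
gen-trade {ρ = ρ} {a} {b} ab∈ρ = subst₂ (Gen ρ) (⊞-identityʳ a) (⊞-identityʳ b) (step ab∈ρ zeros)

gen-map : ∀ {k} {ρ ρ' : List (Trade k)} → (∀ {a b} → (a , b) ∈ ρ → Gen ρ' a b) →
  ∀ {x y} → Gen ρ x y → Gen ρ' x y
gen-map trades (step ab∈ρ u)    = gen-⊞ (trades ab∈ρ) u
gen-map trades Gen.refl         = Gen.refl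
gen-map trades (Gen.sym g)      = Gen.sym (gen-map trades g)
gen-map trades (Gen.trans g g') = Gen.trans (gen-map trades g) (gen-map trades g')

module AtMaximal (N : NilSemigroup) {k : ℕ} (A : AtomEnum N k)
  (p : NilSemigroup.Carrier N) (p-max : NilSemigroup.IsMaximal N p) where

  open NilSemigroup N
  open AtomEnum A
  open Factorization N A
  open NilSemigroupProperties N
  open FactorizationProperties N A
  open OuterBettiDecidable N A

  p≢∞ : p ≢ ∞
  p≢∞ = proj₁ p-max

  𝟘≢∞ : 𝟘 ≢ ∞
  𝟘≢∞ 𝟘≡∞ = p≢∞ (trans (sym (identity p)) (trans (cong (_⊕ p) 𝟘≡∞) (absorbˡ p)))

  p⊕-cases : ∀ u → p ⊕ u ≡ p ⊎ p ⊕ u ≡ ∞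
  p⊕-cases u with u ≟ 𝟘
  ... | yes u≡𝟘 = inj₁ (trans (cong (p ⊕_) u≡𝟘) (identityʳ p))
  ... | no u≢𝟘  = inj₂ (proj₂ p-max u u≢𝟘)

  module _ {w : Vecℕ k} {i : Fin k} (φw≡p : φ w ≡ p) (wᵢ>0 : InSupp w i) where

    lowered-⊕ : φ (w −e i) ⊕ atom i ≡ p
    lowered-⊕ = trans (φ-−e w i wᵢ>0) φw≡p

    lowered-≢∞ : φ (w −e i) ≢ ∞
    lowered-≢∞ = ⊕-≢∞ˡ (λ eq → p≢∞ (trans (sym lowered-⊕) eq))

    lowered-≢p : φ (w −e i) ≢ p
    lowered-≢p eq =
      p≢∞ (trans (sym lowered-⊕) (trans (cong (_⊕ atom i) eq) (proj₂ p-max (atom i) (atom≢𝟘 i))))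

  lowered-cancel : ∀ {x w i} → φ x ≡ p → φ w ≡ p → InSupp x i → InSupp w i →
    φ (x −e i) ≡ φ (w −e i)
  lowered-cancel {x} {w} {i} φx≡p φw≡p xᵢ>0 wᵢ>0 =
    cancel-atom i (trans x-lowered (sym (lowered-⊕ {w} φw≡p wᵢ>0))) (λ eq → p≢∞ (trans (sym x-lowered) eq))
    where
    x-lowered : φ (x −e i) ⊕ atom i ≡ p
    x-lowered = lowered-⊕ {x} φx≡p xᵢ>0

  suppMeet-sym : ∀ {x y : Vecℕ k} → SuppMeet x y → SuppMeet y x
  suppMeet-sym (i , xᵢ>0 , yᵢ>0) = i , yᵢ>0 , xᵢ>0

  factorizationsOfP : List (Vecℕ k)
  factorizationsOfP = filter (λ z → φ z ≟ p) (box nilIndex)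

  ∈-factorizationsOfP⁺ : ∀ {z} → φ z ≡ p → z ∈ factorizationsOfP
  ∈-factorizationsOfP⁺ {z} φz≡p =
    ∈-filter⁺ (λ z → φ z ≟ p) (∈-box-nilIndex z (λ eq → p≢∞ (trans (sym φz≡p) eq))) φz≡p

  ∈-factorizationsOfP⁻ : ∀ {z} → z ∈ factorizationsOfP → φ z ≡ p
  ∈-factorizationsOfP⁻ m = proj₂ (∈-filter⁻ (λ z → φ z ≟ p) {xs = box nilIndex} m)

  -- ∇_{Z(p)} together with extra edges
  open ExtendedGraph (Vec.≡-dec ℕ._≟_) (λ z → φ z ≟ p) factorizationsOfP ∈-factorizationsOfP⁺
                     suppMeet? (λ {x} {y} → suppMeet-sym {x} {y}) public

  module WithoutTrade {ρ : List (Trade k)} (ρ-generates : Generates φ ρ)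
    {t : Trade k} (φt≡p : φ (proj₁ t) ≡ p) {ρ' : List (Trade k)} (ρ'⊆ρ : ρ' ⊆ ρ) (ρ⊆t∷ρ' : ∀ {s} → s ∈ ρ → s ≡ t ⊎ s ∈ ρ') where

    -- applied with an offset u, the trade t acts at p ⊕ φ u, which is p or ∞
    gen-avoiding : ∀ {x y} → Gen ρ x y → φ x ≢ p → φ x ≢ ∞ → Gen ρ' x y
    gen-avoiding (step {a} ab∈ρ u) φ≢p φ≢∞ with ρ⊆t∷ρ' ab∈ρ
    ... | inj₂ ab∈ρ' = step ab∈ρ' u
    ... | inj₁ refl with p⊕-cases (φ u)
    ...   | inj₁ eq = ⊥-elim (φ≢p (trans (φ-⊞ a u) (trans (cong (_⊕ φ u) φt≡p) eq)))
    ...   | inj₂ eq = ⊥-elim (φ≢∞ (trans (φ-⊞ a u) (trans (cong (_⊕ φ u) φt≡p) eq)))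
    gen-avoiding Gen.refl φ≢p φ≢∞ = Gen.refl
    gen-avoiding (Gen.sym g) φ≢p φ≢∞ =
      let φy≡φx = gen-sound ρ-generates g in
      Gen.sym (gen-avoiding g (φ≢p ∘ trans (sym φy≡φx)) (φ≢∞ ∘ trans (sym φy≡φx)))
    gen-avoiding (Gen.trans g g') φ≢p φ≢∞ =
      let φx≡φw = gen-sound ρ-generates g in
      Gen.trans (gen-avoiding g φ≢p φ≢∞) (gen-avoiding g' (φ≢p ∘ trans φx≡φw) (φ≢∞ ∘ trans φx≡φw))

    -- two factorizations of p sharing an atom differ by a relation one level down
    gen-meeting : ∀ {x w} → φ x ≡ p → φ w ≡ p → SuppMeet x w → Gen ρ' x w
    gen-meeting {x} {w} φx≡p φw≡p (j , xⱼ>0 , wⱼ>0) =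
      subst₂ (Gen ρ') (trans (⊞-unit _ j) (−e-+e x j xⱼ>0)) (trans (⊞-unit _ j) (−e-+e w j wⱼ>0))
        (gen-⊞ lowered (unit j))
      where
      lowered : Gen ρ' (x −e j) (w −e j)
      lowered = gen-avoiding (gen-complete ρ-generates (lowered-cancel {x} {w} φx≡p φw≡p xⱼ>0 wⱼ>0))
                             (lowered-≢p {x} φx≡p xⱼ>0) (lowered-≢∞ {x} φx≡p xⱼ>0)

    reach⇒gen : ∀ {es} → es ⊆ ρ' → ∀ {x y} → Reach es x y → Gen ρ' x y
    reach⇒gen es⊆ρ' ε = Gen.refl
    reach⇒gen es⊆ρ' ((φx≡p , φw≡p , inj₁ meet) ◅ path) =
      Gen.trans (gen-meeting φx≡p φw≡p meet) (reach⇒gen es⊆ρ' path)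
    reach⇒gen es⊆ρ' ((_ , _ , inj₂ (inj₁ xw∈es)) ◅ path) =
      Gen.trans (gen-trade (es⊆ρ' xw∈es)) (reach⇒gen es⊆ρ' path)
    reach⇒gen es⊆ρ' ((_ , _ , inj₂ (inj₂ wx∈es)) ◅ path) =
      Gen.trans (Gen.sym (gen-trade (es⊆ρ' wx∈es))) (reach⇒gen es⊆ρ' path)

    generates-without : Gen ρ' (proj₁ t) (proj₂ t) → Generates φ ρ'
    generates-without gen-t z z' =
      mk⇔ (to (ρ-generates z z') ∘ gen-map (gen-trade ∘ ρ'⊆ρ)) (gen-map replace ∘ from (ρ-generates z z'))
      where
      replace : ∀ {a b} → (a , b) ∈ ρ → Gen ρ' a b
      replace ab∈ρ with ρ⊆t∷ρ' ab∈ρ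
      ... | inj₁ refl  = gen-t
      ... | inj₂ ab∈ρ' = gen-trade ab∈ρ'

  module MinimalPresentation {ρ : List (Trade k)} (ρ-minimal : MinimalGenerating φ ρ) where

    ρ-generates : Generates φ ρ
    ρ-generates = proj₁ ρ-minimal

    relationsAtP : List (Trade k)
    relationsAtP = filter (λ t → φ (proj₁ t) ≟ p) ρ

    relationsAtP-ends : All (λ (a , b) → φ a ≡ p × φ b ≡ p) relationsAtP
    relationsAtP-ends = All.tabulate λ m →
      let ab∈ρ , φa≡p = ∈-filter⁻ (λ t → φ (proj₁ t) ≟ p) {xs = ρ} m in
      φa≡p , trans (sym (gen-sound ρ-generates (gen-trade ab∈ρ))) φa≡p

    -- by minimality, no relation at p is implied by the later ones
    relation-independent : ∀ ρ₁ t ρ₂ → ρ₁ ++ t ∷ ρ₂ ≡ ρ → φ (proj₁ t) ≡ p →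
      ¬ Reach (filter (λ t → φ (proj₁ t) ≟ p) ρ₂) (proj₁ t) (proj₂ t)
    relation-independent ρ₁ t ρ₂ refl φt≡p reach with removeAt-middle ρ₁ t ρ₂
    ... | i , removed =
      proj₂ ρ-minimal i (subst (Generates φ) (sym removed) (generates-without (reach⇒gen later⊆ reach)))
      where
      open WithoutTrade ρ-generates φt≡p (⊆-middle ρ₁) (∈-middle ρ₁)
      later⊆ : filter (λ t → φ (proj₁ t) ≟ p) ρ₂ ⊆ ρ₁ ++ ρ₂
      later⊆ m = ∈-++⁺ʳ ρ₁ (proj₁ (∈-filter⁻ (λ t → φ (proj₁ t) ≟ p) {xs = ρ₂} m))

    relationsAtP-suffix-forest : ∀ ρ₁ ρ₂ → ρ₁ ++ ρ₂ ≡ ρ → Forest (filter (λ t → φ (proj₁ t) ≟ p) ρ₂)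
    relationsAtP-suffix-forest ρ₁ []       _  = tt
    relationsAtP-suffix-forest ρ₁ (t ∷ ρ₂) eq with φ (proj₁ t) ≟ p
    ... | yes φt≡p = relation-independent ρ₁ t ρ₂ eq φt≡p , later
      where
      later : Forest (filter (λ t → φ (proj₁ t) ≟ p) ρ₂)
      later = relationsAtP-suffix-forest (ρ₁ ++ [ t ]) ρ₂ (trans (++-assoc ρ₁ [ t ] ρ₂) eq)
    ... | no _     = relationsAtP-suffix-forest (ρ₁ ++ [ t ]) ρ₂ (trans (++-assoc ρ₁ [ t ] ρ₂) eq)

    relationsAtP-forest : Forest relationsAtP
    relationsAtP-forest = relationsAtP-suffix-forest [] ρ refl

    -- a relation applied with a nonzero offset u connects two factorizations sharing the support of u
    gen⇒reach : ∀ {x y} → Gen ρ x y → φ x ≡ p → Reach relationsAtP x y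
    gen⇒reach (step {a} {b} ab∈ρ u) φ≡p with Fin.any? (inSupp? u)
    ... | yes (i , uᵢ>0) =
      return (φ≡p , trans (sym (gen-sound ρ-generates (step ab∈ρ u))) φ≡p , inj₁ (i , supp a , supp b))
      where
      supp : ∀ c → InSupp (c ⊞ u) i
      supp c = subst (0 <_) (sym (lookup-⊞ c u i)) (≤-trans uᵢ>0 (m≤n+m _ _))
    ... | no ¬supp = subst₂ (Reach relationsAtP) (sym (drop-u a)) (sym (drop-u b))
        (return (φa≡p , trans (sym (gen-sound ρ-generates (gen-trade ab∈ρ))) φa≡p ,
                 inj₂ (inj₁ (∈-filter⁺ (λ t → φ (proj₁ t) ≟ p) ab∈ρ φa≡p))))
      where
      drop-u : ∀ c → c ⊞ u ≡ c
      drop-u c = trans (cong (c ⊞_) (supp-empty⇒zeros u (λ i uᵢ>0 → ¬supp (i , uᵢ>0)))) (⊞-identityʳ c)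
      φa≡p : φ a ≡ p
      φa≡p = trans (cong φ (sym (drop-u a))) φ≡p
    gen⇒reach Gen.refl         φ≡p = ε
    gen⇒reach (Gen.sym g)      φ≡p = reach-sym (gen⇒reach g (trans (gen-sound ρ-generates g) φ≡p))
    gen⇒reach (Gen.trans g g') φ≡p =
      gen⇒reach g φ≡p ◅◅ gen⇒reach g' (trans (sym (gen-sound ρ-generates g)) φ≡p)

    components-at-p : components [] ≡ length relationsAtP + 1
    components-at-p = begin
      components []
        ≡⟨ components-forest relationsAtP relationsAtP-forest relationsAtP-ends ⟩
      length relationsAtP + components relationsAtP
        ≡⟨ cong (length relationsAtP +_) (components-connected relationsAtP z₀∈ connected) ⟩
      length relationsAtP + 1 ∎
      where
      open ≡-Reasoning
      z₀∈ : proj₁ (factorization 𝟘≢∞ p p≢∞) ∈ factorizationsOfP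
      z₀∈ = ∈-factorizationsOfP⁺ (proj₂ (factorization 𝟘≢∞ p p≢∞))
      connected : ∀ {y z} → y ∈ factorizationsOfP → z ∈ factorizationsOfP → Reach relationsAtP y z
      connected y∈ z∈ =
        let φy≡p = ∈-factorizationsOfP⁻ y∈ ; φz≡p = ∈-factorizationsOfP⁻ z∈ in
        gen⇒reach (gen-complete ρ-generates (trans φy≡p (sym φz≡p))) φy≡p

module QuotientByMaximal (N : NilSemigroup) {k : ℕ} (A : AtomEnum N k)
  (p : NilSemigroup.Carrier N) (p-max : NilSemigroup.IsMaximal N p) where

  open NilSemigroup N
  open AtomEnum A
  open Factorization N A
  open Betti N A
  open NilSemigroupProperties N
  open FactorizationProperties N A
  open OuterBettiDecidable N A
  open AtMaximal N A p p-max

  divisible? : ∀ B → Dec (DivisibleBy p B)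
  divisible? B = Fin.any? (λ j → inSuppSet? B j ×-dec minusEquals? B j p p≢∞)

  divisible-invariant : ≋-Invariant (DivisibleBy p)
  divisible-invariant B≋B' (j , (z , z∈B , zⱼ>0) , eq) =
    j , (z , to (B≋B' z) z∈B , zⱼ>0) , minusEquals-invariant B≋B' eq

  OuterBettiAtP : List (Vecℕ k) → Set
  OuterBettiAtP B = OuterBettiQuot p B × (∀ z → z ∈ B → φ z ≡ p)

  quotient-outerBetti-split : ∀ {B} → OuterBettiQuot p B →
    (OuterBetti B × ¬ DivisibleBy p B) ⊎ OuterBettiAtP B
  quotient-outerBetti-split {B} B-outer@(zinf , cond , conn) with all? (λ z → φ z ≟ ∞) B
  ... | yes all∞ = inj₁ (((λ z → All.lookup all∞) , cond' , conn) , ¬divisible)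
    where
    cond' : ∀ i → InSuppSet B i → Σ Carrier λ q → q ≢ ∞ × MinusEquals B i q
    cond' i supp = let q , (q≢∞ , _) , eq = cond i supp in q , q≢∞ , eq
    ¬divisible : ¬ DivisibleBy p B
    ¬divisible (j , supp@(z , z∈B , zⱼ>0) , eqp) =
      let q , (_ , q≢p) , eq = cond j supp in
      q≢p (trans (sym (minusEquals-value z∈B zⱼ>0 eq)) (minusEquals-value z∈B zⱼ>0 eqp))
  ... | no ¬all∞ =
    let z , z∈B , φz≢∞ = find (¬All⇒Any¬ (λ z → φ z ≟ ∞) B ¬all∞) in
    inj₂ (B-outer , λ y y∈B → trans (φ-constant B-outer z∈B y∈B) (φ≡p z∈B φz≢∞))
    where
    φ≡p : ∀ {z} → z ∈ B → φ z ≢ ∞ → φ z ≡ p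
    φ≡p z∈B φz≢∞ with zinf _ z∈B
    ... | inj₁ φz≡∞ = ⊥-elim (φz≢∞ φz≡∞)
    ... | inj₂ φz≡p = φz≡p

  undivisible⇒quotient : ∀ {B} → OuterBetti B × ¬ DivisibleBy p B → OuterBettiQuot p B
  undivisible⇒quotient {B} ((zinf , cond , conn) , ¬div) =
    (λ z z∈B → inj₁ (zinf z z∈B)) ,
    (λ i supp → let q , q≢∞ , eq = cond i supp in
                q , (q≢∞ , λ q≡p → ¬div (i , supp , subst (MinusEquals B i) q≡p eq)) , eq) ,
    conn

  undivisible-disjoint : ∀ {B B'} → OuterBetti B × ¬ DivisibleBy p B → OuterBettiAtP B' → ¬ (B ≋ B')
  undivisible-disjoint ((zinf , _ , (z , z∈B) , _) , _) (_ , all-p) B≋B' =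
    p≢∞ (trans (sym (all-p z (to (B≋B' z) z∈B))) (zinf z z∈B))

  component : Vecℕ k → List (Vecℕ k)
  component x = filter (reach? [] x) factorizationsOfP

  ∈-component⁺ : ∀ {x y} → Reach [] x y → y ∈ factorizationsOfP → y ∈ component x
  ∈-component⁺ {x} x↝y y∈ = ∈-filter⁺ (reach? [] x) y∈ x↝y

  ∈-component⁻ : ∀ {x y} → y ∈ component x → Reach [] x y × φ y ≡ p
  ∈-component⁻ {x} m =
    let y∈ , x↝y = ∈-filter⁻ (reach? [] x) {xs = factorizationsOfP} m in x↝y , ∈-factorizationsOfP⁻ y∈

  ∈-component-step : ∀ {x w y} → w ∈ component x → φ y ≡ p → SuppMeet w y → y ∈ component x
  ∈-component-step w∈ φy≡p meet =
    let x↝w , φw≡p = ∈-component⁻ w∈ in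
    ∈-component⁺ (x↝w ◅◅ return (φw≡p , φy≡p , inj₁ meet)) (∈-factorizationsOfP⁺ φy≡p)

  component-minusEquals : ∀ {x w i} → w ∈ component x → InSupp w i →
    MinusEquals (component x) i (φ (w −e i))
  component-minusEquals {x} {w} {i} w∈ wᵢ>0 y = mk⇔ lowered lifted
    where
    φw≡p : φ w ≡ p
    φw≡p = proj₂ (∈-component⁻ w∈)
    lowered : MinusE (component x) i y → φ y ≡ φ (w −e i)
    lowered (z , z∈ , zᵢ>0 , y≡) =
      trans (cong φ y≡) (lowered-cancel {z} {w} (proj₂ (∈-component⁻ z∈)) φw≡p zᵢ>0 wᵢ>0)
    lifted : φ y ≡ φ (w −e i) → MinusE (component x) i y
    lifted φy≡q =
      y +e i , ∈-component-step w∈ φy+≡p (i , wᵢ>0 , +e-supp y i) , +e-supp y i , sym (+e-−e y i)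
      where
      φy+≡p : φ (y +e i) ≡ p
      φy+≡p = trans (φ-+e y i) (trans (cong (_⊕ atom i) φy≡q) (lowered-⊕ {w} φw≡p wᵢ>0))

  reach⇒walk : ∀ {x y z} → y ∈ component x → Reach [] y z → Walk (component x) y z
  reach⇒walk y∈ ε = here
  reach⇒walk y∈ ((_ , φw≡p , inj₁ meet) ◅ path) =
    let w∈ = ∈-component-step y∈ φw≡p meet in next w∈ meet (reach⇒walk w∈ path)
  reach⇒walk y∈ ((_ , _ , inj₂ (inj₁ ())) ◅ _)
  reach⇒walk y∈ ((_ , _ , inj₂ (inj₂ ())) ◅ _)

  component-outerBettiAtP : ∀ {x} → φ x ≡ p → OuterBettiAtP (component x)
  component-outerBettiAtP {x} φx≡p = (zinf , cond , (x , x∈) , walks) , λ z z∈ → proj₂ (∈-component⁻ z∈)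
    where
    x∈ : x ∈ component x
    x∈ = ∈-component⁺ ε (∈-factorizationsOfP⁺ φx≡p)
    zinf : ∀ z → z ∈ component x → Z ∞ z ⊎ Z p z
    zinf z z∈ = inj₂ (proj₂ (∈-component⁻ z∈))
    cond : ∀ i → InSuppSet (component x) i →
      Σ Carrier λ q → (q ≢ ∞ × q ≢ p) × MinusEquals (component x) i q
    cond i (w , w∈ , wᵢ>0) =
      let φw≡p = proj₂ (∈-component⁻ w∈) in
      φ (w −e i) , (lowered-≢∞ {w} φw≡p wᵢ>0 , lowered-≢p {w} φw≡p wᵢ>0) ,
      component-minusEquals w∈ wᵢ>0
    walks : ∀ y z → y ∈ component x → z ∈ component x → Walk (component x) y z
    walks y z y∈ z∈ =
      reach⇒walk y∈ (reach-sym (proj₁ (∈-component⁻ y∈)) ◅◅ proj₁ (∈-component⁻ z∈))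

  walk⇒reach : ∀ {B x y} → (∀ z → z ∈ B → φ z ≡ p) → x ∈ B → Walk B x y → Reach [] x y
  walk⇒reach all-p x∈B here = ε
  walk⇒reach all-p x∈B (next w∈B meet walk) =
    (all-p _ x∈B , all-p _ w∈B , inj₁ meet) ◅ walk⇒reach all-p w∈B walk

  outerBettiAtP-closed : ∀ {B w y} → OuterBettiAtP B → w ∈ B → Reach [] w y → y ∈ B
  outerBettiAtP-closed B-outer w∈B ε = w∈B
  outerBettiAtP-closed {B} {w} B-outer@((_ , cond , _) , all-p) w∈B
                       (_◅_ {j = v} (_ , φv≡p , inj₁ (i , wᵢ>0 , vᵢ>0)) path) =
    outerBettiAtP-closed B-outer v∈B path
    where
    eq : MinusEquals B i (proj₁ (cond i (w , w∈B , wᵢ>0)))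
    eq = proj₂ (proj₂ (cond i (w , w∈B , wᵢ>0)))
    lowered : MinusE B i (v −e i)
    lowered = from (eq (v −e i))
      (trans (lowered-cancel {v} {w} φv≡p (all-p w w∈B) vᵢ>0 wᵢ>0) (minusEquals-value w∈B wᵢ>0 eq))
    v∈B : v ∈ B
    v∈B = let u , u∈B , uᵢ>0 , v≡u = lowered in
      subst (_∈ B) (sym (−e-injective v u i vᵢ>0 uᵢ>0 v≡u)) u∈B
  outerBettiAtP-closed B-outer w∈B ((_ , _ , inj₂ (inj₁ ())) ◅ _)
  outerBettiAtP-closed B-outer w∈B ((_ , _ , inj₂ (inj₂ ())) ◅ _)

  outerBettiAtP-≋ : ∀ {B z ℓ} → OuterBettiAtP B → z ∈ B → Reach [] z ℓ → B ≋ component ℓ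
  outerBettiAtP-≋ B-outer@((_ , _ , _ , walks) , all-p) z∈B z↝ℓ y = mk⇔
    (λ y∈B → ∈-component⁺ (reach-sym z↝ℓ ◅◅ walk⇒reach all-p z∈B (walks _ y z∈B y∈B))
                          (∈-factorizationsOfP⁺ (all-p y y∈B)))
    (λ y∈ → outerBettiAtP-closed B-outer z∈B (z↝ℓ ◅◅ proj₁ (∈-component⁻ y∈)))

  numberOfOuterBettiAtP : NumberOf OuterBettiAtP (components [])
  numberOfOuterBettiAtP =
    map component reps , length-map component reps ,
    All.map⁺ (All.tabulate (component-outerBettiAtP ∘ ∈-factorizationsOfP⁻ ∘ reps⊆)) ,
    AllPairs-map-⊆ component reps⊆ distinct (representatives-unrelated factorizationsOfP) ,
    cover
    where
    open Representatives (reach? [])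
    reps : List (Vecℕ k)
    reps = representatives factorizationsOfP
    reps⊆ : reps ⊆ factorizationsOfP
    reps⊆ = representatives-⊆ factorizationsOfP
    distinct : ∀ {x y} → x ∈ factorizationsOfP → y ∈ factorizationsOfP → ¬ Reach [] x y →
      ¬ (component x ≋ component y)
    distinct x∈ y∈ ¬x↝y same =
      ¬x↝y (reach-sym (proj₁ (∈-component⁻ (to (same _) (∈-component⁺ ε x∈)))))
    cover : ∀ B → OuterBettiAtP B → Any (B ≋_) (map component reps)
    cover B B-outer@((_ , _ , (z , z∈B) , _) , all-p) =
      let ℓ , ℓ∈ , z↝ℓ = find (representatives-cover ε _◅◅_ _ (∈-factorizationsOfP⁺ (all-p z z∈B))) in
      lose (∈-map⁺ component ℓ∈) (outerBettiAtP-≋ B-outer z∈B z↝ℓ)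

quotient-count : ∀ d e k → (d + e) + k + 1 ≡ (e + (k + 1)) + d
quotient-count = solve-∀

quotient-bound : ∀ d e k → (e + (k + 1)) ∸ 1 ≤ (d + e) + k
quotient-bound d e k = begin
  (e + (k + 1)) ∸ 1   ≡⟨ cong (λ n → (e + n) ∸ 1) (+-comm k 1) ⟩
  (e + suc k) ∸ 1     ≡⟨ cong (_∸ 1) (+-suc e k) ⟩
  e + k               ≤⟨ m≤n+m (e + k) d ⟩
  d + (e + k)         ≡⟨ +-assoc d e k ⟨
  (d + e) + k         ∎
  where
  open Data.Nat.Properties.≤-Reasoning

lemma3p3 : (N : NilSemigroup) (k' : ℕ) (A : AtomEnum N k')
    (p : NilSemigroup.Carrier N) → NilSemigroup.IsMaximal N p →
    (ρ : List (Trade k')) → MinimalGenerating (Factorization.φ N A) ρ →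
    (k : ℕ) → Betti.relationsAt N A p ρ ≡ k →
    Σ ℕ λ bN → Σ ℕ λ bNp → Σ ℕ λ d →
      NumberOf (Betti.OuterBetti N A) bN ×
      NumberOf (Betti.OuterBettiQuot N A p) bNp ×
      NumberOf (λ B → Betti.OuterBetti N A B × Betti.DivisibleBy N A p B) d ×
      bN + k + 1 ≡ bNp + d ×
      bNp ∸ 1 ≤ bN + k
lemma3p3 N k' A p p-max ρ ρ-minimal _ refl =
  let open QuotientByMaximal N A p p-max
      open AtMaximal.MinimalPresentation N A p p-max ρ-minimal
      k = length relationsAtP
      _ , outerBetti = OuterBettiDecidable.numberOfOuterBetti N A
      d , e , divisible , undivisible , d+e≡bN = numberOf-split outerBetti divisible? divisible-invariant
      quotientOuterBetti = numberOf-union undivisible numberOfOuterBettiAtP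
        undivisible-disjoint quotient-outerBetti-split undivisible⇒quotient proj₁
  in  d + e , e + (k + 1) , d ,
      subst (NumberOf _) (sym d+e≡bN) outerBetti ,
      subst (λ c → NumberOf _ (e + c)) components-at-p quotientOuterBetti ,
      divisible ,
      quotient-count d e k , quotient-bound d e k
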